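{- Let $f \geqslant 3$ be an integer. Then the disjoint union $C_f\cup C_{2^{f+1}(f+1)!-f}$ is an $(f+2,f)$-lift graph of type I.
   Context: A graph means an undirected simple graph; $A(\Gamma)$ is the adjacency matrix, $\operatorname{Char}_{A}(x)=\det(xI-A)$, $\mathsf c_k(p)$ is the coefficient of $x^{\deg p-k}$ in a polynomial $p$, and $\mathbf 1$ is the all-ones vector. $C_n$ is the cycle graph on vertex set $\mathbb Z/n\mathbb Z$ with $i$ adjacent to $i\pm1$. For positive integers $e,f$, a graph $\Gamma$ is an $(e,f)$-lift graph of type I if (a) $2^{e-2}$ divides $\mathbf 1^\top A(\Gamma)^k\mathbf 1$ for every integer $k\geqslant 0$, and (b) for each $k\in\{1,\dots,e-1\}$, $\mathsf c_k(\operatorname{Char}_{A(\Gamma)})\equiv 0 \pmod{2^{e-k}}$ if $k\neq f$, and $\mathsf c_f(\operatorname{Char}_{A(\Gamma)})\equiv 2^{e-f-1}\pmod{2^{e-f}}$. -}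

module Defs where

open import Data.Nat as ℕ using (ℕ; zero; suc; _∸_; _≡ᵇ_; _%_)
open import Data.Integer as ℤ using (ℤ; +_; _+_; _*_; -_; _-_)
open import Data.Integer.Divisibility using (_∣_)
open import Data.Fin using (Fin; zero; suc; toℕ; splitAt; punchIn; _≟_)
open import Data.Bool using (Bool; true; false; _∨_; if_then_else_)
open import Data.Sum using (inj₁; inj₂)
open import Data.List using (List; []; _∷_; length; reverse)
open import Data.Product using (_×_)
open import Relation.Nullary.Decidable using (⌊_⌋)
open import Relation.Nullary using (¬_)
open import Relation.Binary.PropositionalEquality using (_≡_)

Graph : ℕ → Set
Graph n = Fin n → Fin n → Bool

cycleG : (n : ℕ) → Graph n
cycleG zero ()
cycleG (suc m) i j =
  ((ℕ._+_ (toℕ i) 1 % suc m) ≡ᵇ toℕ j) ∨ ((ℕ._+_ (toℕ j) 1 % suc m) ≡ᵇ toℕ i)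

_⊕G_ : {m n : ℕ} → Graph m → Graph n → Graph (ℕ._+_ m n)
_⊕G_ {m} G H i j with splitAt m i | splitAt m j
... | inj₁ a | inj₁ b = G a b
... | inj₂ a | inj₂ b = H a b
... | inj₁ _ | inj₂ _ = false
... | inj₂ _ | inj₁ _ = false

Matrix : Set → ℕ → Set
Matrix A n = Fin n → Fin n → A

b2ℤ : Bool → ℤ
b2ℤ true = + 1
b2ℤ false = + 0

adjMatrix : {n : ℕ} → Graph n → Matrix ℤ n
adjMatrix G i j = b2ℤ (G i j)

sumFin : {n : ℕ} → (Fin n → ℤ) → ℤ
sumFin {zero} f = + 0
sumFin {suc n} f = f zero + sumFin (λ i → f (suc i))

idM : {n : ℕ} → Matrix ℤ n
idM i j = if ⌊ i ≟ j ⌋ then + 1 else + 0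

mulM : {n : ℕ} → Matrix ℤ n → Matrix ℤ n → Matrix ℤ n
mulM A B i j = sumFin (λ k → A i k * B k j)

powM : {n : ℕ} → Matrix ℤ n → ℕ → Matrix ℤ n
powM A zero = idM
powM A (suc k) = mulM A (powM A k)

onesForm : {n : ℕ} → Matrix ℤ n → ℤ
onesForm M = sumFin (λ i → sumFin (λ j → M i j))

-- Polynomials over ℤ: coefficient lists, lowest degree first
-- (trailing zeros allowed; see degree / coefficient below).

Poly : Set
Poly = List ℤ

addP : Poly → Poly → Poly
addP [] q = q
addP p [] = p
addP (a ∷ p) (b ∷ q) = (a + b) ∷ addP p q

scaleP : ℤ → Poly → Poly
scaleP c [] = []
scaleP c (a ∷ p) = (c * a) ∷ scaleP c p

mulP : Poly → Poly → Poly
mulP [] q = []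
mulP (a ∷ p) q = addP (scaleP a q) (+ 0 ∷ mulP p q)

negP : Poly → Poly
negP = scaleP (- + 1)

sumFinP : {n : ℕ} → (Fin n → Poly) → Poly
sumFinP {zero} f = []
sumFinP {suc n} f = addP (f zero) (sumFinP (λ i → f (suc i)))

sign : ℕ → ℤ
sign zero = + 1
sign (suc zero) = - + 1
sign (suc (suc k)) = sign k

detP : {n : ℕ} → Matrix Poly n → Poly
detP {zero} M = + 1 ∷ []
detP {suc n} M =
  sumFinP (λ j → scaleP (sign (toℕ j))
                   (mulP (M zero j) (detP (λ i k → M (suc i) (punchIn j k)))))

charPoly : {n : ℕ} → Matrix ℤ n → Poly
charPoly A = detP (λ i j → if ⌊ i ≟ j ⌋ then (- A i j) ∷ + 1 ∷ [] else (- A i j) ∷ [])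

dropZerosRev : List ℤ → List ℤ
dropZerosRev [] = []
dropZerosRev (+ 0 ∷ p) = dropZerosRev p
dropZerosRev p@(_ ∷ _) = p

normP : Poly → Poly
normP p = reverse (dropZerosRev (reverse p))

-- degree (the zero polynomial is given degree 0)
degP : Poly → ℕ
degP p = length (normP p) ∸ 1

coeffP : Poly → ℕ → ℤ
coeffP [] k = + 0
coeffP (a ∷ p) zero = a
coeffP (a ∷ p) (suc k) = coeffP p k

c_ : ℕ → Poly → ℤ
c_ k p = coeffP p (degP p ∸ k)

_≋_[mod_] : ℤ → ℤ → ℕ → Set
a ≋ b [mod m ] = (+ m) ∣ (a - b)

record LiftTypeI (e f : ℕ) {n : ℕ} (Γ : Graph n) : Set where
  field
    walks : ∀ (k : ℕ) → (+ (2 ℕ.^ (e ∸ 2))) ∣ onesForm (powM (adjMatrix Γ) k)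
    coeffs-other : ∀ (k : ℕ) → 1 ℕ.≤ k → k ℕ.≤ e ∸ 1 → ¬ (k ≡ f) →
      (c_ k (charPoly (adjMatrix Γ))) ≋ + 0 [mod 2 ℕ.^ (e ∸ k) ]
    coeff-f : 1 ℕ.≤ f → f ℕ.≤ e ∸ 1 →
      (c_ f (charPoly (adjMatrix Γ))) ≋ + (2 ℕ.^ (e ∸ f ∸ 1)) [mod 2 ℕ.^ (e ∸ f) ]

{-# OPTIONS --safe #-}
-- Γ = C_f ⊔ C_m, m = n − f, n = 2^(f+1)·(f+1)!, is 2-regular on n vertices, so 1ᵀAᵏ1 = n·2ᵏ.
-- Laplace expansion along the first row (through the tridiagonal determinants of paths) gives
-- Char(C_k) = v_k − 2 for the Vieta–Lucas polynomial v_k, so Char(Γ) = (v_f − 2)(v_m − 2).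
-- As v_f·v_m = v_n + v_(m−f), the coefficients c_κ (κ ≤ f + 1) of this product are those of v_n,
-- except that c_f also receives −2 times the leading coefficient of v_m. The coefficient of
-- x^(n−κ) in v_n is 0 for odd κ and ±(n/j)·C(n−j−1, j−1) for κ = 2j, hence a multiple of
-- 2^(f+1) since j divides (f+1)!. So 2^(f+1) divides c_κ for κ ≠ f, and c_f ≡ −2 ≡ 2 (mod 4).
module Submission where

open import Defs

module Polynomial where

  open import Data.Nat using (zero; suc)
  open import Data.Integer as ℤ using (ℤ; +_; _+_; _*_; -_)
  import Data.Integer.Properties as ℤ
  open import Data.Integer.Tactic.RingSolver using (solve-∀)
  open import Data.List using ([]; _∷_)
  open import Data.Maybe using (Maybe; just; nothing)
  open import Data.Product using (_,_)
  open import Level using (0ℓ)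
  open import Algebra.Bundles using (CommutativeRing)
  open import Tactic.RingSolver.Core.AlmostCommutativeRing
    using (AlmostCommutativeRing; fromCommutativeRing)
  open import Relation.Binary.PropositionalEquality

  -- coefficient lists may carry trailing zeros, so polynomials are compared coefficientwise
  infix 4 _≈_
  record _≈_ (p q : Poly) : Set where
    constructor coeffwise
    field coeff≡ : ∀ k → coeffP p k ≡ coeffP q k
  open _≈_ public

  ≈-refl : ∀ {p} → p ≈ p
  ≈-refl .coeff≡ k = refl

  ≈-sym : ∀ {p q} → p ≈ q → q ≈ p
  ≈-sym p≈q .coeff≡ k = sym (p≈q .coeff≡ k)

  ≈-trans : ∀ {p q r} → p ≈ q → q ≈ r → p ≈ r
  ≈-trans p≈q q≈r .coeff≡ k = trans (p≈q .coeff≡ k) (q≈r .coeff≡ k)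

  ≡⇒≈ : ∀ {p q} → p ≡ q → p ≈ q
  ≡⇒≈ refl = ≈-refl

  ∷-cong : ∀ {a b p q} → a ≡ b → p ≈ q → (a ∷ p) ≈ (b ∷ q)
  ∷-cong a≡b p≈q .coeff≡ zero = a≡b
  ∷-cong a≡b p≈q .coeff≡ (suc k) = p≈q .coeff≡ k

  ∷-injectiveʳ : ∀ {a b p q} → (a ∷ p) ≈ (b ∷ q) → p ≈ q
  ∷-injectiveʳ a∷p≈b∷q .coeff≡ k = a∷p≈b∷q .coeff≡ (suc k)

  ∷≈[]⇒≈[] : ∀ {a p} → (a ∷ p) ≈ [] → p ≈ []
  ∷≈[]⇒≈[] a∷p≈[] .coeff≡ k = a∷p≈[] .coeff≡ (suc k)

  coeffP-addP : ∀ p q k → coeffP (addP p q) k ≡ coeffP p k + coeffP q k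
  coeffP-addP [] q k = sym (ℤ.+-identityˡ _)
  coeffP-addP (a ∷ p) [] k = sym (ℤ.+-identityʳ _)
  coeffP-addP (a ∷ p) (b ∷ q) zero = refl
  coeffP-addP (a ∷ p) (b ∷ q) (suc k) = coeffP-addP p q k

  coeffP-scaleP : ∀ c p k → coeffP (scaleP c p) k ≡ c * coeffP p k
  coeffP-scaleP c [] k = sym (ℤ.*-zeroʳ c)
  coeffP-scaleP c (a ∷ p) zero = refl
  coeffP-scaleP c (a ∷ p) (suc k) = coeffP-scaleP c p k

  coeffP-negP : ∀ p k → coeffP (negP p) k ≡ - coeffP p k
  coeffP-negP p k = trans (coeffP-scaleP (- + 1) p k) (ℤ.-1*i≡-i _)

  coeffP-mulP-zero : ∀ a p q → coeffP (mulP (a ∷ p) q) 0 ≡ a * coeffP q 0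
  coeffP-mulP-zero a p q
    rewrite coeffP-addP (scaleP a q) (+ 0 ∷ mulP p q) 0 | coeffP-scaleP a q 0 = ℤ.+-identityʳ _

  coeffP-mulP-suc : ∀ a p q k →
    coeffP (mulP (a ∷ p) q) (suc k) ≡ a * coeffP q (suc k) + coeffP (mulP p q) k
  coeffP-mulP-suc a p q k
    rewrite coeffP-addP (scaleP a q) (+ 0 ∷ mulP p q) (suc k) | coeffP-scaleP a q (suc k) = refl

  coeffP-mulP-∷ʳ-zero : ∀ p b q → coeffP (mulP p (b ∷ q)) 0 ≡ coeffP p 0 * b
  coeffP-mulP-∷ʳ-zero [] b q = refl
  coeffP-mulP-∷ʳ-zero (a ∷ p) b q = coeffP-mulP-zero a p (b ∷ q)

  coeffP-mulP-∷ʳ-suc : ∀ p b q k →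
    coeffP (mulP p (b ∷ q)) (suc k) ≡ coeffP p (suc k) * b + coeffP (mulP p q) k
  coeffP-mulP-∷ʳ-suc [] b q k = refl
  coeffP-mulP-∷ʳ-suc (a ∷ p) b q zero
    rewrite coeffP-mulP-suc a p (b ∷ q) 0 | coeffP-mulP-∷ʳ-zero p b q | coeffP-mulP-zero a p q =
      ℤ.+-comm (a * coeffP q 0) _
  coeffP-mulP-∷ʳ-suc (a ∷ p) b q (suc k)
    rewrite coeffP-mulP-suc a p (b ∷ q) (suc k) | coeffP-mulP-∷ʳ-suc p b q k
          | coeffP-mulP-suc a p q k =
      swap (a * coeffP q (suc k)) (coeffP p (suc k) * b) (coeffP (mulP p q) k)
    where
    swap : ∀ x y z → x + (y + z) ≡ y + (x + z)
    swap = solve-∀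

  addP-cong : ∀ {p p′ q q′} → p ≈ p′ → q ≈ q′ → addP p q ≈ addP p′ q′
  addP-cong {p} {p′} {q} {q′} p≈p′ q≈q′ .coeff≡ k
    rewrite coeffP-addP p q k | coeffP-addP p′ q′ k = cong₂ _+_ (p≈p′ .coeff≡ k) (q≈q′ .coeff≡ k)

  addP-congˡ : ∀ p {q q′} → q ≈ q′ → addP p q ≈ addP p q′
  addP-congˡ p = addP-cong (≈-refl {p})

  addP-congʳ : ∀ q {p p′} → p ≈ p′ → addP p q ≈ addP p′ q
  addP-congʳ q p≈p′ = addP-cong p≈p′ (≈-refl {q})

  scaleP-cong : ∀ c {p q} → p ≈ q → scaleP c p ≈ scaleP c q
  scaleP-cong c {p} {q} p≈q .coeff≡ k
    rewrite coeffP-scaleP c p k | coeffP-scaleP c q k = cong (c *_) (p≈q .coeff≡ k)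

  negP-cong : ∀ {p q} → p ≈ q → negP p ≈ negP q
  negP-cong = scaleP-cong (- + 1)

  mulP-zeroˡ : ∀ {p} q → p ≈ [] → mulP p q ≈ []
  mulP-zeroˡ {[]} q p≈[] = ≈-refl
  mulP-zeroˡ {a ∷ p} q a∷p≈[] .coeff≡ zero
    rewrite coeffP-mulP-zero a p q | a∷p≈[] .coeff≡ 0 = refl
  mulP-zeroˡ {a ∷ p} q a∷p≈[] .coeff≡ (suc k)
    rewrite coeffP-mulP-suc a p q k | a∷p≈[] .coeff≡ 0
          | ℤ.*-zeroˡ (coeffP q (suc k)) | ℤ.+-identityˡ (coeffP (mulP p q) k) =
      mulP-zeroˡ q (∷≈[]⇒≈[] a∷p≈[]) .coeff≡ k

  mulP-congʳ : ∀ p {q q′} → q ≈ q′ → mulP p q ≈ mulP p q′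
  mulP-congʳ [] q≈q′ = ≈-refl
  mulP-congʳ (a ∷ p) {q} {q′} q≈q′ .coeff≡ zero
    rewrite coeffP-mulP-zero a p q | coeffP-mulP-zero a p q′ = cong (a *_) (q≈q′ .coeff≡ 0)
  mulP-congʳ (a ∷ p) {q} {q′} q≈q′ .coeff≡ (suc k)
    rewrite coeffP-mulP-suc a p q k | coeffP-mulP-suc a p q′ k =
      cong₂ _+_ (cong (a *_) (q≈q′ .coeff≡ (suc k))) (mulP-congʳ p q≈q′ .coeff≡ k)

  mulP-congˡ : ∀ {p p′} q → p ≈ p′ → mulP p q ≈ mulP p′ q
  mulP-congˡ {[]} q []≈p′ = ≈-sym (mulP-zeroˡ q (≈-sym []≈p′))
  mulP-congˡ {a ∷ p} {[]} q a∷p≈[] = mulP-zeroˡ q a∷p≈[]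
  mulP-congˡ {a ∷ p} {a′ ∷ p′} q p≈p′ .coeff≡ zero
    rewrite coeffP-mulP-zero a p q | coeffP-mulP-zero a′ p′ q =
      cong (_* coeffP q 0) (p≈p′ .coeff≡ 0)
  mulP-congˡ {a ∷ p} {a′ ∷ p′} q p≈p′ .coeff≡ (suc k)
    rewrite coeffP-mulP-suc a p q k | coeffP-mulP-suc a′ p′ q k =
      cong₂ _+_ (cong (_* coeffP q (suc k)) (p≈p′ .coeff≡ 0))
                (mulP-congˡ q (∷-injectiveʳ p≈p′) .coeff≡ k)

  mulP-cong : ∀ {p p′ q q′} → p ≈ p′ → q ≈ q′ → mulP p q ≈ mulP p′ q′
  mulP-cong {p′ = p′} {q} p≈p′ q≈q′ = ≈-trans (mulP-congˡ q p≈p′) (mulP-congʳ p′ q≈q′)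

  addP-comm : ∀ p q → addP p q ≈ addP q p
  addP-comm p q .coeff≡ k
    rewrite coeffP-addP p q k | coeffP-addP q p k = ℤ.+-comm (coeffP p k) _

  addP-assoc : ∀ p q r → addP (addP p q) r ≈ addP p (addP q r)
  addP-assoc p q r .coeff≡ k
    rewrite coeffP-addP (addP p q) r k | coeffP-addP p q k
          | coeffP-addP p (addP q r) k | coeffP-addP q r k = ℤ.+-assoc (coeffP p k) _ _

  addP-identityʳ : ∀ p → addP p [] ≈ p
  addP-identityʳ p .coeff≡ k rewrite coeffP-addP p [] k = ℤ.+-identityʳ _

  addP-inverseˡ : ∀ p → addP (negP p) p ≈ []
  addP-inverseˡ p .coeff≡ k
    rewrite coeffP-addP (negP p) p k | coeffP-negP p k = ℤ.+-inverseˡ (coeffP p k)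

  addP-inverseʳ : ∀ p → addP p (negP p) ≈ []
  addP-inverseʳ p = ≈-trans (addP-comm p (negP p)) (addP-inverseˡ p)

  mulP-zeroʳ : ∀ p → mulP p [] ≈ []
  mulP-zeroʳ [] = ≈-refl
  mulP-zeroʳ (a ∷ p) .coeff≡ zero = trans (coeffP-mulP-zero a p []) (ℤ.*-zeroʳ a)
  mulP-zeroʳ (a ∷ p) .coeff≡ (suc k) =
    trans (coeffP-mulP-suc a p [] k) (cong₂ _+_ (ℤ.*-zeroʳ a) (mulP-zeroʳ p .coeff≡ k))

  mulP-comm : ∀ p q → mulP p q ≈ mulP q p
  mulP-comm [] q = ≈-sym (mulP-zeroʳ q)
  mulP-comm (a ∷ p) q .coeff≡ zero
    rewrite coeffP-mulP-zero a p q | coeffP-mulP-∷ʳ-zero q a p = ℤ.*-comm a _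
  mulP-comm (a ∷ p) q .coeff≡ (suc k)
    rewrite coeffP-mulP-suc a p q k | coeffP-mulP-∷ʳ-suc q a p k =
      cong₂ _+_ (ℤ.*-comm a _) (mulP-comm p q .coeff≡ k)

  mulP-distribˡ : ∀ p q r → mulP p (addP q r) ≈ addP (mulP p q) (mulP p r)
  mulP-distribˡ [] q r = ≈-refl
  mulP-distribˡ (a ∷ p) q r .coeff≡ zero
    rewrite coeffP-mulP-zero a p (addP q r) | coeffP-addP q r 0
          | coeffP-addP (mulP (a ∷ p) q) (mulP (a ∷ p) r) 0
          | coeffP-mulP-zero a p q | coeffP-mulP-zero a p r = ℤ.*-distribˡ-+ a _ _
  mulP-distribˡ (a ∷ p) q r .coeff≡ (suc k)
    rewrite coeffP-mulP-suc a p (addP q r) k | coeffP-addP q r (suc k)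
          | coeffP-addP (mulP (a ∷ p) q) (mulP (a ∷ p) r) (suc k)
          | coeffP-mulP-suc a p q k | coeffP-mulP-suc a p r k
          | mulP-distribˡ p q r .coeff≡ k | coeffP-addP (mulP p q) (mulP p r) k =
      regroup a (coeffP q (suc k)) _ _ _
    where
    regroup : ∀ a x y u v → a * (x + y) + (u + v) ≡ (a * x + u) + (a * y + v)
    regroup = solve-∀

  mulP-distribʳ : ∀ p q r → mulP (addP q r) p ≈ addP (mulP q p) (mulP r p)
  mulP-distribʳ p q r =
    ≈-trans (mulP-comm (addP q r) p)
      (≈-trans (mulP-distribˡ p q r) (addP-cong (mulP-comm p q) (mulP-comm p r)))

  mulP-scaleˡ : ∀ c q r → mulP (scaleP c q) r ≈ scaleP c (mulP q r)
  mulP-scaleˡ c [] r = ≈-refl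
  mulP-scaleˡ c (b ∷ q) r .coeff≡ zero
    rewrite coeffP-mulP-zero (c * b) (scaleP c q) r | coeffP-scaleP c (mulP (b ∷ q) r) 0
          | coeffP-mulP-zero b q r = ℤ.*-assoc c b _
  mulP-scaleˡ c (b ∷ q) r .coeff≡ (suc k)
    rewrite coeffP-mulP-suc (c * b) (scaleP c q) r k | coeffP-scaleP c (mulP (b ∷ q) r) (suc k)
          | coeffP-mulP-suc b q r k | mulP-scaleˡ c q r .coeff≡ k
          | coeffP-scaleP c (mulP q r) k =
      trans (cong (_+ _) (ℤ.*-assoc c b _)) (sym (ℤ.*-distribˡ-+ c _ _))

  mulP-assoc : ∀ p q r → mulP (mulP p q) r ≈ mulP p (mulP q r)
  mulP-assoc [] q r = ≈-refl
  mulP-assoc (a ∷ p) q r =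
    ≈-trans (mulP-distribʳ r (scaleP a q) (+ 0 ∷ mulP p q))
      (addP-cong (mulP-scaleˡ a q r) (≈-trans (shiftˡ (mulP p q)) (∷-cong refl (mulP-assoc p q r))))
    where
    shiftˡ : ∀ s → mulP (+ 0 ∷ s) r ≈ (+ 0 ∷ mulP s r)
    shiftˡ s .coeff≡ zero rewrite coeffP-mulP-zero (+ 0) s r = refl
    shiftˡ s .coeff≡ (suc k) rewrite coeffP-mulP-suc (+ 0) s r k = ℤ.+-identityˡ _

  mulP-identityˡ : ∀ p → mulP (+ 1 ∷ []) p ≈ p
  mulP-identityˡ p .coeff≡ k
    rewrite coeffP-addP (scaleP (+ 1) p) (+ 0 ∷ []) k | coeffP-scaleP (+ 1) p k =
      trans (cong₂ _+_ (ℤ.*-identityˡ (coeffP p k)) (coeffP-0∷[] k)) (ℤ.+-identityʳ (coeffP p k))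
    where
    coeffP-0∷[] : ∀ k → coeffP (+ 0 ∷ []) k ≡ + 0
    coeffP-0∷[] zero = refl
    coeffP-0∷[] (suc k) = refl

  polyRing : CommutativeRing 0ℓ 0ℓ
  polyRing = record
    { Carrier = Poly ; _≈_ = _≈_ ; _+_ = addP ; _*_ = mulP ; -_ = negP ; 0# = [] ; 1# = + 1 ∷ []
    ; isCommutativeRing = record
      { isRing = record
        { +-isAbelianGroup = record
          { isGroup = record
            { isMonoid = record
              { isSemigroup = record
                { isMagma = record
                  { isEquivalence = record { refl = ≈-refl ; sym = ≈-sym ; trans = ≈-trans }
                  ; ∙-cong = addP-cong }
                ; assoc = addP-assoc }
              ; identity = (λ p → ≈-refl) , addP-identityʳ }
            ; inverse = addP-inverseˡ , addP-inverseʳ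
            ; ⁻¹-cong = negP-cong }
          ; comm = addP-comm }
        ; *-cong = mulP-cong
        ; *-assoc = mulP-assoc
        ; *-identity = mulP-identityˡ , λ p → ≈-trans (mulP-comm p _) (mulP-identityˡ p)
        ; distrib = mulP-distribˡ , mulP-distribʳ }
      ; *-comm = mulP-comm } }

  isZero? : ∀ p → Maybe ([] ≈ p)
  isZero? [] = just ≈-refl
  isZero? (+ 0 ∷ p) with isZero? p
  ... | just []≈p = just (coeffwise λ { zero → refl ; (suc k) → []≈p .coeff≡ k })
  ... | nothing = nothing
  isZero? (_ ∷ p) = nothing

  polyAlmostRing : AlmostCommutativeRing 0ℓ 0ℓ
  polyAlmostRing = fromCommutativeRing polyRing isZero?

  const : ℤ → Poly
  const a = a ∷ []

  X : Poly
  X = + 0 ∷ + 1 ∷ []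

  scaleP≈const* : ∀ c p → scaleP c p ≈ mulP (const c) p
  scaleP≈const* c p .coeff≡ zero = trans (coeffP-scaleP c p 0) (sym (coeffP-mulP-zero c [] p))
  scaleP≈const* c p .coeff≡ (suc k) =
    trans (coeffP-scaleP c p (suc k))
      (sym (trans (coeffP-mulP-suc c [] p k) (ℤ.+-identityʳ (c * coeffP p (suc k)))))

  scaleP-identity : ∀ p → scaleP (+ 1) p ≈ p
  scaleP-identity p .coeff≡ k = trans (coeffP-scaleP (+ 1) p k) (ℤ.*-identityˡ (coeffP p k))

  coeffP-const* : ∀ c p k → coeffP (mulP (const c) p) k ≡ c * coeffP p k
  coeffP-const* c p k = trans (sym (scaleP≈const* c p .coeff≡ k)) (coeffP-scaleP c p k)

module Determinant where

  open Polynomial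
  open import Tactic.RingSolver.Core.AlmostCommutativeRing using (AlmostCommutativeRing)
  open AlmostCommutativeRing polyAlmostRing
    using (_+_; _*_; -_; 0#; 1#; setoid; +-identityʳ; *-identityˡ; *-identityʳ)
  open import Data.Nat using (zero; suc) renaming (_+_ to _+ℕ_)
  open import Data.Integer using (+_)
  open import Data.Fin using (Fin; zero; suc; toℕ; punchIn; punchOut; inject₁; fromℕ; _↑ˡ_; _↑ʳ_)
  open import Data.Fin.Properties using (punchIn-punchOut; toℕ-↑ˡ; suc-injective)
  open import Function using (_∘_)
  open import Relation.Binary.PropositionalEquality using (_≡_; _≢_; refl; sym; cong; subst)
  open import Relation.Binary.Reasoning.Setoid setoid

  minor : ∀ {n} → Matrix Poly (suc n) → Fin (suc n) → Matrix Poly n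
  minor M j i k = M (suc i) (punchIn j k)

  cofactorTerm : ∀ {n} → Matrix Poly (suc n) → Fin (suc n) → Poly
  cofactorTerm M j = scaleP (sign (toℕ j)) (M zero j * detP (minor M j))

  sumFinP-cong : ∀ {n} {f g : Fin n → Poly} → (∀ j → f j ≈ g j) → sumFinP f ≈ sumFinP g
  sumFinP-cong {zero} f≈g = ≈-refl
  sumFinP-cong {suc n} f≈g = addP-cong (f≈g zero) (sumFinP-cong (λ j → f≈g (suc j)))

  sumFinP-zero : ∀ {n} (f : Fin n → Poly) → (∀ j → f j ≈ 0#) → sumFinP f ≈ 0#
  sumFinP-zero {zero} f f≈0 = ≈-refl
  sumFinP-zero {suc n} f f≈0 = addP-cong (f≈0 zero) (sumFinP-zero (λ j → f (suc j)) (λ j → f≈0 (suc j)))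

  sumFinP-↑ : ∀ m n (f : Fin (m +ℕ n) → Poly) →
    sumFinP f ≈ sumFinP (λ a → f (a ↑ˡ n)) + sumFinP (λ b → f (m ↑ʳ b))
  sumFinP-↑ zero n f = ≈-refl
  sumFinP-↑ (suc m) n f =
    ≈-trans (addP-cong (≈-refl {f zero}) (sumFinP-↑ m n (λ i → f (suc i))))
            (≈-sym (addP-assoc (f zero) _ _))

  sumFinP-*ʳ : ∀ {n} (f : Fin n → Poly) q → sumFinP (λ a → f a * q) ≈ sumFinP f * q
  sumFinP-*ʳ {zero} f q = ≈-refl
  sumFinP-*ʳ {suc n} f q =
    ≈-trans (addP-cong (≈-refl {f zero * q}) (sumFinP-*ʳ (λ a → f (suc a)) q))
            (≈-sym (mulP-distribʳ q (f zero) (sumFinP (λ a → f (suc a)))))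

  sumFinP-single : ∀ {n} (f : Fin n → Poly) c → (∀ j → j ≢ c → f j ≈ 0#) → sumFinP f ≈ f c
  sumFinP-single {suc n} f zero others≈0 =
    ≈-trans (addP-cong (≈-refl {f zero}) (sumFinP-zero _ λ j → others≈0 (suc j) λ ()))
            (+-identityʳ (f zero))
  sumFinP-single {suc n} f (suc c) others≈0 =
    addP-cong (others≈0 zero λ ())
              (sumFinP-single (λ j → f (suc j)) c λ j j≢c → others≈0 (suc j) (j≢c ∘ suc-injective))

  sumFinP-last : ∀ {n} (f : Fin (suc n) → Poly) → (∀ j → f (inject₁ j) ≈ 0#) → sumFinP f ≈ f (fromℕ n)
  sumFinP-last {zero} f _ = +-identityʳ (f zero)
  sumFinP-last {suc n} f init≈0 =
    addP-cong (init≈0 zero) (sumFinP-last (λ j → f (suc j)) (λ j → init≈0 (suc j)))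

  detP-cong : ∀ {n} {M N : Matrix Poly n} → (∀ i j → M i j ≈ N i j) → detP M ≈ detP N
  detP-cong {zero} M≈N = ≈-refl
  detP-cong {suc n} M≈N = sumFinP-cong λ j →
    scaleP-cong (sign (toℕ j)) (mulP-cong (M≈N zero j) (detP-cong λ i k → M≈N (suc i) (punchIn j k)))

  cofactorTerm-zeroEntry : ∀ {n} (M : Matrix Poly (suc n)) j → M zero j ≈ 0# → cofactorTerm M j ≈ 0#
  cofactorTerm-zeroEntry M j M₀ⱼ≈0 = scaleP-cong (sign (toℕ j)) (mulP-zeroˡ (detP (minor M j)) M₀ⱼ≈0)

  cofactorTerm-zeroMinor : ∀ {n} (M : Matrix Poly (suc n)) j → detP (minor M j) ≈ 0# → cofactorTerm M j ≈ 0#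
  cofactorTerm-zeroMinor M j det≈0 =
    scaleP-cong (sign (toℕ j)) (≈-trans (mulP-congʳ (M zero j) det≈0) (mulP-zeroʳ (M zero j)))

  detP-zeroColumn : ∀ {n} (M : Matrix Poly n) c → (∀ i → M i c ≈ 0#) → detP M ≈ 0#
  detP-column : ∀ {n} (M : Matrix Poly (suc n)) c → (∀ i → M (suc i) c ≈ 0#) → detP M ≈ cofactorTerm M c

  detP-zeroColumn {suc n} M c column≈0 =
    ≈-trans (detP-column M c (λ i → column≈0 (suc i))) (cofactorTerm-zeroEntry M c (column≈0 zero))

  detP-column M c column≈0 = sumFinP-single (cofactorTerm M) c λ j j≢c →
    cofactorTerm-zeroMinor M j (detP-zeroColumn (minor M j) (punchOut j≢c) λ i →
      subst (λ k → M (suc i) k ≈ 0#) (sym (punchIn-punchOut j≢c)) (column≈0 i))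

  detP-column₀ : ∀ {n} (M : Matrix Poly (suc n)) → (∀ i → M (suc i) zero ≈ 0#) →
                 detP M ≈ M zero zero * detP (minor M zero)
  detP-column₀ M column₀≈0 = ≈-trans (detP-column M zero column₀≈0) (scaleP-identity _)

  detP-cong-column₀ : ∀ {n} (M N : Matrix Poly (suc n)) →
    (∀ i → M i zero ≈ N i zero) → (∀ i k → M i (suc k) ≈ N i (suc k)) → detP M ≈ detP N
  detP-cong-column₀ M N column₀≈ rest≈ =
    detP-cong {M = M} {N} λ { i zero → column₀≈ i ; i (suc k) → rest≈ i k }

  detP₁ : (M : Matrix Poly 1) → detP M ≈ M zero zero
  detP₁ M = ≈-trans (+-identityʳ (cofactorTerm M zero))
                   (≈-trans (scaleP-identity (M zero zero * 1#)) (*-identityʳ (M zero zero)))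

  detP-expand₂ : ∀ {n} (M : Matrix Poly (suc (suc n))) → (∀ j → M zero (suc (suc j)) ≈ 0#) →
    detP M ≈ M zero zero * detP (minor M zero) + - (M zero (suc zero) * detP (minor M (suc zero)))
  detP-expand₂ M rest≈0 = addP-cong (scaleP-identity (M zero zero * detP (minor M zero)))
    (≈-trans (addP-cong (≈-refl {cofactorTerm M (suc zero)})
                        (sumFinP-zero _ λ j → cofactorTerm-zeroEntry M (suc (suc j)) (rest≈0 j)))
             (+-identityʳ (cofactorTerm M (suc zero))))

  detP-expand₃ : ∀ {n} (M : Matrix Poly (suc (suc (suc n)))) → (∀ j → M zero (suc (suc (suc j))) ≈ 0#) →
    detP M ≈ M zero zero * detP (minor M zero)
           + (- (M zero (suc zero) * detP (minor M (suc zero)))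
           + M zero (suc (suc zero)) * detP (minor M (suc (suc zero))))
  detP-expand₃ M rest≈0 =
    addP-cong (scaleP-identity (M zero zero * detP (minor M zero)))
      (addP-congˡ (cofactorTerm M (suc zero))
        (≈-trans (addP-cong (scaleP-identity (M zero (suc (suc zero)) * detP (minor M (suc (suc zero)))))
                            (sumFinP-zero _ λ j → cofactorTerm-zeroEntry M (suc (suc (suc j))) (rest≈0 j)))
                 (+-identityʳ _)))

  record BlockDiagonal {m n} (R : Matrix Poly (m +ℕ n)) (P : Matrix Poly m) (Q : Matrix Poly n) : Set where
    field
      upperLeft : ∀ a b → R (a ↑ˡ n) (b ↑ˡ n) ≈ P a b
      lowerRight : ∀ a b → R (m ↑ʳ a) (m ↑ʳ b) ≈ Q a b
      upperRight : ∀ a b → R (a ↑ˡ n) (m ↑ʳ b) ≈ 0#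
      lowerLeft : ∀ a b → R (m ↑ʳ a) (b ↑ˡ n) ≈ 0#
  open BlockDiagonal

  private
    punchIn-↑ˡ : ∀ {m} n (a : Fin (suc m)) (b : Fin m) → punchIn (a ↑ˡ n) (b ↑ˡ n) ≡ punchIn a b ↑ˡ n
    punchIn-↑ˡ n zero b = refl
    punchIn-↑ˡ n (suc a) zero = refl
    punchIn-↑ˡ n (suc a) (suc b) = cong suc (punchIn-↑ˡ n a b)

    punchIn-↑ʳ : ∀ m {n} (a : Fin (suc m)) (b : Fin n) → punchIn (a ↑ˡ n) (m ↑ʳ b) ≡ suc m ↑ʳ b
    punchIn-↑ʳ m zero b = refl
    punchIn-↑ʳ (suc m) (suc a) b = cong suc (punchIn-↑ʳ m a b)

  minor-blockDiagonal : ∀ {m n R P Q} → BlockDiagonal {suc m} {n} R P Q → ∀ a →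
                        BlockDiagonal {m} {n} (minor R (a ↑ˡ n)) (minor P a) Q
  minor-blockDiagonal {m} {n} {R} {P} {Q} R=P⊕Q a = record
    { upperLeft = λ x y → subst (λ z → R (suc (x ↑ˡ n)) z ≈ P (suc x) (punchIn a y))
                            (sym (punchIn-↑ˡ n a y)) (upperLeft R=P⊕Q (suc x) (punchIn a y))
    ; lowerRight = λ x y → subst (λ z → R (suc (m ↑ʳ x)) z ≈ Q x y)
                             (sym (punchIn-↑ʳ m a y)) (lowerRight R=P⊕Q x y)
    ; upperRight = λ x y → subst (λ z → R (suc (x ↑ˡ n)) z ≈ 0#)
                             (sym (punchIn-↑ʳ m a y)) (upperRight R=P⊕Q (suc x) y)
    ; lowerLeft = λ x y → subst (λ z → R (suc (m ↑ʳ x)) z ≈ 0#)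
                            (sym (punchIn-↑ˡ n a y)) (lowerLeft R=P⊕Q x (punchIn a y))
    }

  detP-blockDiagonal : ∀ {m n R P Q} → BlockDiagonal {m} {n} R P Q → detP R ≈ detP P * detP Q
  detP-blockDiagonal {zero} {n} {R} {P} {Q} R=P⊕Q =
    ≈-trans (detP-cong (lowerRight R=P⊕Q)) (≈-sym (*-identityˡ (detP Q)))
  detP-blockDiagonal {suc m} {n} {R} {P} {Q} R=P⊕Q = begin
    detP R
      ≈⟨ sumFinP-↑ (suc m) n (cofactorTerm R) ⟩
    sumFinP (λ a → cofactorTerm R (a ↑ˡ n)) + sumFinP (λ b → cofactorTerm R (suc m ↑ʳ b))
      ≈⟨ addP-cong (sumFinP-cong leftTerm) (sumFinP-zero _ λ b →
           cofactorTerm-zeroEntry R (suc m ↑ʳ b) (upperRight R=P⊕Q zero b)) ⟩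
    sumFinP (λ a → cofactorTerm P a * detP Q) + 0#
      ≈⟨ +-identityʳ _ ⟩
    sumFinP (λ a → cofactorTerm P a * detP Q)
      ≈⟨ sumFinP-*ʳ (cofactorTerm P) (detP Q) ⟩
    detP P * detP Q ∎
    where
    leftTerm : ∀ a → cofactorTerm R (a ↑ˡ n) ≈ cofactorTerm P a * detP Q
    leftTerm a = begin
      scaleP (sign (toℕ (a ↑ˡ n))) (R zero (a ↑ˡ n) * detP (minor R (a ↑ˡ n)))
        ≡⟨ cong (λ i → scaleP (sign i) (R zero (a ↑ˡ n) * detP (minor R (a ↑ˡ n)))) (toℕ-↑ˡ a n) ⟩
      scaleP (sign (toℕ a)) (R zero (a ↑ˡ n) * detP (minor R (a ↑ˡ n)))
        ≈⟨ scaleP-cong _ (mulP-cong (upperLeft R=P⊕Q zero a)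
                                    (detP-blockDiagonal (minor-blockDiagonal R=P⊕Q a))) ⟩
      scaleP (sign (toℕ a)) (P zero a * (detP (minor P a) * detP Q))
        ≈⟨ scaleP-cong _ (≈-sym (mulP-assoc (P zero a) _ _)) ⟩
      scaleP (sign (toℕ a)) ((P zero a * detP (minor P a)) * detP Q)
        ≈⟨ ≈-sym (mulP-scaleˡ (sign (toℕ a)) (P zero a * detP (minor P a)) (detP Q)) ⟩
      cofactorTerm P a * detP Q ∎

module CycleDeterminant where

  open Polynomial
  open Determinant
  open import Tactic.RingSolver.Core.AlmostCommutativeRing using (AlmostCommutativeRing)
  open AlmostCommutativeRing polyAlmostRing using (_+_; _*_; -_; 0#; 1#; setoid; *-identityʳ)
  open import Tactic.RingSolver using (solve-∀)
  open import Data.Nat using (ℕ; zero; suc)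
  open import Data.Integer using (+_)
  open import Data.Fin using (Fin; zero; suc; toℕ; inject₁; fromℕ; punchIn)
  open import Data.Fin.Properties using (toℕ-fromℕ)
  open import Relation.Binary.PropositionalEquality using (_≡_; refl; cong; subst; sym)
  open import Relation.Binary.Reasoning.Setoid setoid

  pathMatrix : ∀ {n} → Matrix Poly n
  pathMatrix zero zero = X
  pathMatrix zero (suc zero) = - 1#
  pathMatrix zero (suc (suc _)) = 0#
  pathMatrix (suc i) (suc j) = pathMatrix i j
  pathMatrix (suc zero) zero = - 1#
  pathMatrix (suc (suc _)) zero = 0#

  pathPoly : ℕ → Poly
  pathPoly zero = 1#
  pathPoly (suc zero) = X
  pathPoly (suc (suc n)) = X * pathPoly (suc n) + - pathPoly n

  -- rows 1, 2, … and columns 0, 1, … of pathMatrix: upper triangular with -1 on the diagonal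
  shiftedPathMatrix : ∀ {n} → Matrix Poly n
  shiftedPathMatrix i k = pathMatrix (suc i) (inject₁ k)

  withColumn₀ : ∀ {n} → (Fin n → Poly) → Matrix Poly n → Matrix Poly n
  withColumn₀ v M i zero = v i
  withColumn₀ v M i (suc k) = M i (suc k)

  negLast : ∀ {n} → Fin (suc n) → Poly
  negLast {zero} zero = - 1#
  negLast {suc n} zero = 0#
  negLast {suc n} (suc i) = negLast i

  negFirstLast : ∀ {n} → Fin (suc (suc n)) → Poly
  negFirstLast zero = - 1#
  negFirstLast (suc i) = negLast i

  const-sign-suc : ∀ n → const (sign (suc n)) ≈ - const (sign n)
  const-sign-suc zero = ≈-refl
  const-sign-suc (suc zero) = ≈-refl
  const-sign-suc (suc (suc n)) = const-sign-suc n

  const-sign² : ∀ n → const (sign n) * const (sign n) ≈ 1#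
  const-sign² zero = ≈-refl
  const-sign² (suc zero) = ≈-refl
  const-sign² (suc (suc n)) = const-sign² n

  private
    -1*x≈-x : ∀ x → - 1# * x ≈ - x
    -1*x≈-x = solve-∀ polyAlmostRing

    -[-1*x]≈x : ∀ x → - (- 1# * x) ≈ x
    -[-1*x]≈x = solve-∀ polyAlmostRing

  detP-withColumn₀-pathMatrix : ∀ n (v : Fin (suc (suc n)) → Poly) →
    detP (withColumn₀ v pathMatrix)
      ≈ v zero * detP (pathMatrix {suc n}) + detP (withColumn₀ (λ i → v (suc i)) pathMatrix)
  detP-withColumn₀-pathMatrix n v = begin
    detP M
      ≈⟨ detP-expand₂ M (λ j → ≈-refl) ⟩
    v zero * detP (pathMatrix {suc n}) + - (- 1# * detP (minor M (suc zero)))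
      ≈⟨ addP-congˡ (v zero * detP (pathMatrix {suc n})) (-[-1*x]≈x (detP (minor M (suc zero)))) ⟩
    v zero * detP (pathMatrix {suc n}) + detP (minor M (suc zero))
      ≈⟨ addP-congˡ (v zero * detP (pathMatrix {suc n}))
           (detP-cong-column₀ (minor M (suc zero)) M′ (λ i → ≈-refl) (λ i k → ≈-refl)) ⟩
    v zero * detP (pathMatrix {suc n}) + detP M′ ∎
    where
    M : Matrix Poly (suc (suc n))
    M = withColumn₀ v pathMatrix
    M′ : Matrix Poly (suc n)
    M′ = withColumn₀ (λ i → v (suc i)) pathMatrix

  detP-pathMatrix : ∀ n → detP (pathMatrix {n}) ≈ pathPoly n
  detP-pathMatrix zero = ≈-refl
  detP-pathMatrix (suc zero) = detP₁ pathMatrix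
  detP-pathMatrix (suc (suc n)) = begin
    detP (pathMatrix {suc (suc n)})
      ≈⟨ detP-cong-column₀ pathMatrix (withColumn₀ column₀ pathMatrix)
                           (λ i → ≈-refl) (λ i k → ≈-refl) ⟩
    detP (withColumn₀ column₀ pathMatrix)
      ≈⟨ detP-withColumn₀-pathMatrix n column₀ ⟩
    X * detP (pathMatrix {suc n}) + detP M′
      ≈⟨ addP-cong (mulP-congʳ X (detP-pathMatrix (suc n))) (detP-column₀ M′ λ i → ≈-refl) ⟩
    X * pathPoly (suc n) + - 1# * detP (pathMatrix {n})
      ≈⟨ addP-congˡ (X * pathPoly (suc n))
           (≈-trans (mulP-congʳ (- 1#) (detP-pathMatrix n)) (-1*x≈-x (pathPoly n))) ⟩
    pathPoly (suc (suc n)) ∎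
    where
    column₀ : Fin (suc (suc n)) → Poly
    column₀ i = pathMatrix i zero
    M′ : Matrix Poly (suc n)
    M′ = withColumn₀ (λ i → column₀ (suc i)) pathMatrix

  detP-negLast-pathMatrix : ∀ n → detP (withColumn₀ negLast (pathMatrix {suc n})) ≈ - 1#
  detP-negLast-pathMatrix zero = detP₁ (withColumn₀ negLast pathMatrix)
  detP-negLast-pathMatrix (suc n) =
    ≈-trans (detP-withColumn₀-pathMatrix n negLast) (detP-negLast-pathMatrix n)

  detP-negFirstLast-pathMatrix : ∀ n →
    detP (withColumn₀ negFirstLast (pathMatrix {suc (suc n)})) ≈ - pathPoly (suc n) + - 1#
  detP-negFirstLast-pathMatrix n =
    ≈-trans (detP-withColumn₀-pathMatrix n negFirstLast)
      (addP-cong (≈-trans (mulP-congʳ (- 1#) (detP-pathMatrix (suc n))) (-1*x≈-x (pathPoly (suc n))))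
                 (detP-negLast-pathMatrix n))

  detP-shiftedPathMatrix : ∀ n → detP (shiftedPathMatrix {n}) ≈ const (sign n)
  detP-shiftedPathMatrix zero = ≈-refl
  detP-shiftedPathMatrix (suc n) = begin
    detP (shiftedPathMatrix {suc n})
      ≈⟨ detP-column₀ (shiftedPathMatrix {suc n}) (λ i → ≈-refl) ⟩
    - 1# * detP (shiftedPathMatrix {n})
      ≈⟨ ≈-trans (mulP-congʳ (- 1#) (detP-shiftedPathMatrix n)) (-1*x≈-x (const (sign n))) ⟩
    - const (sign n)
      ≈⟨ ≈-sym (const-sign-suc n) ⟩
    const (sign (suc n)) ∎

  detP-withColumn₀-shiftedPathMatrix : ∀ n (v : Fin (suc (suc (suc n))) → Poly) →
    detP (withColumn₀ v shiftedPathMatrix)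
      ≈ v zero * detP (shiftedPathMatrix {suc (suc n)})
        + (- (X * detP (withColumn₀ (λ i → v (suc i)) shiftedPathMatrix))
        + - detP (withColumn₀ (λ i → v (suc (suc i))) (shiftedPathMatrix {suc n})))
  detP-withColumn₀-shiftedPathMatrix n v = begin
    detP M
      ≈⟨ detP-expand₃ M (λ j → ≈-refl) ⟩
    v zero * detP (shiftedPathMatrix {suc (suc n)})
      + (- (X * detP (minor M (suc zero))) + - 1# * detP M₂)
      ≈⟨ addP-congˡ (v zero * detP (shiftedPathMatrix {suc (suc n)}))
           (addP-cong (negP-cong (mulP-congʳ X (detP-cong-column₀ (minor M (suc zero)) M′
                                                  (λ i → ≈-refl) (λ i k → ≈-refl))))
                      (≈-trans (mulP-congʳ (- 1#) det₂) (-1*x≈-x (detP M″)))) ⟩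
    v zero * detP (shiftedPathMatrix {suc (suc n)}) + (- (X * detP M′) + - detP M″) ∎
    where
    M : Matrix Poly (suc (suc (suc n)))
    M = withColumn₀ v shiftedPathMatrix
    M₂ M′ : Matrix Poly (suc (suc n))
    M₂ = minor M (suc (suc zero))
    M′ = withColumn₀ (λ i → v (suc i)) shiftedPathMatrix
    M″ : Matrix Poly (suc n)
    M″ = withColumn₀ (λ i → v (suc (suc i))) shiftedPathMatrix
    det₂ : detP M₂ ≈ detP M″
    det₂ = begin
      detP M₂
        ≈⟨ detP-column M₂ (suc zero) (λ i → ≈-refl) ⟩
      - (- 1# * detP (minor M₂ (suc zero)))
        ≈⟨ -[-1*x]≈x (detP (minor M₂ (suc zero))) ⟩
      detP (minor M₂ (suc zero))
        ≈⟨ detP-cong-column₀ (minor M₂ (suc zero)) M″ (λ i → ≈-refl) (λ i k → ≈-refl) ⟩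
      detP M″ ∎

  detP-negLast-shiftedPathMatrix : ∀ n →
    detP (withColumn₀ negLast (shiftedPathMatrix {suc n})) ≈ const (sign (suc n)) * pathPoly n
  detP-negLast-shiftedPathMatrix zero =
    ≈-trans (detP₁ (withColumn₀ negLast shiftedPathMatrix)) (≈-sym (*-identityʳ (- 1#)))
  detP-negLast-shiftedPathMatrix (suc zero) = begin
    detP M
      ≈⟨ detP-expand₂ M (λ ()) ⟩
    - (X * detP (minor M (suc zero)))
      ≈⟨ negP-cong (mulP-congʳ X (detP₁ (minor M (suc zero)))) ⟩
    - (X * - 1#)
      ≈⟨ identity X ⟩
    1# * X ∎
    where
    M : Matrix Poly 2
    M = withColumn₀ negLast shiftedPathMatrix
    identity : ∀ x → - (x * - 1#) ≈ 1# * x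
    identity = solve-∀ polyAlmostRing
  detP-negLast-shiftedPathMatrix (suc (suc n)) = begin
    detP (withColumn₀ negLast (shiftedPathMatrix {suc (suc (suc n))}))
      ≈⟨ detP-withColumn₀-shiftedPathMatrix n negLast ⟩
    - (X * detP (withColumn₀ negLast (shiftedPathMatrix {suc (suc n)})))
      + - detP (withColumn₀ negLast (shiftedPathMatrix {suc n}))
      ≈⟨ addP-cong (negP-cong (mulP-congʳ X (≈-trans (detP-negLast-shiftedPathMatrix (suc n))
                                                     (mulP-congˡ (pathPoly (suc n)) (const-sign-suc (suc n))))))
                   (negP-cong (detP-negLast-shiftedPathMatrix n)) ⟩
    - (X * (- c * pathPoly (suc n))) + - (c * pathPoly n)
      ≈⟨ identity c X (pathPoly (suc n)) (pathPoly n) ⟩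
    c * pathPoly (suc (suc n)) ∎
    where
    c : Poly
    c = const (sign (suc n))
    identity : ∀ c x p₁ p₀ → - (x * (- c * p₁)) + - (c * p₀) ≈ c * (x * p₁ + - p₀)
    identity = solve-∀ polyAlmostRing

  detP-negFirstLast-shiftedPathMatrix : ∀ n →
    detP (withColumn₀ negFirstLast (shiftedPathMatrix {suc (suc n)})) ≈ const (sign n) * (pathPoly (suc n) + 1#)
  detP-negFirstLast-shiftedPathMatrix zero = begin
    detP M
      ≈⟨ detP-expand₂ M (λ ()) ⟩
    - 1# * detP (shiftedPathMatrix {1}) + - (X * detP (minor M (suc zero)))
      ≈⟨ addP-cong (mulP-congʳ (- 1#) (detP-shiftedPathMatrix 1))
                   (negP-cong (mulP-congʳ X (detP₁ (minor M (suc zero))))) ⟩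
    - 1# * - 1# + - (X * - 1#)
      ≈⟨ identity X ⟩
    1# * (X + 1#) ∎
    where
    M : Matrix Poly 2
    M = withColumn₀ negFirstLast shiftedPathMatrix
    identity : ∀ x → - 1# * - 1# + - (x * - 1#) ≈ 1# * (x + 1#)
    identity = solve-∀ polyAlmostRing
  detP-negFirstLast-shiftedPathMatrix (suc n) = begin
    detP (withColumn₀ negFirstLast (shiftedPathMatrix {suc (suc (suc n))}))
      ≈⟨ detP-withColumn₀-shiftedPathMatrix n negFirstLast ⟩
    - 1# * detP (shiftedPathMatrix {suc (suc n)})
      + (- (X * detP (withColumn₀ negLast (shiftedPathMatrix {suc (suc n)})))
      + - detP (withColumn₀ negLast (shiftedPathMatrix {suc n})))
      ≈⟨ addP-cong (mulP-congʳ (- 1#) (≈-trans (detP-shiftedPathMatrix (suc (suc n))) (const-sign-suc (suc n))))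
           (addP-cong (negP-cong (mulP-congʳ X (≈-trans (detP-negLast-shiftedPathMatrix (suc n))
                                                        (mulP-congˡ (pathPoly (suc n)) (const-sign-suc (suc n))))))
                      (negP-cong (detP-negLast-shiftedPathMatrix n))) ⟩
    - 1# * - c + (- (X * (- c * pathPoly (suc n))) + - (c * pathPoly n))
      ≈⟨ identity c X (pathPoly (suc n)) (pathPoly n) ⟩
    c * (pathPoly (suc (suc n)) + 1#) ∎
    where
    c : Poly
    c = const (sign (suc n))
    identity : ∀ c x p₁ p₀ → - 1# * - c + (- (x * (- c * p₁)) + - (c * p₀)) ≈ c * ((x * p₁ + - p₀) + 1#)
    identity = solve-∀ polyAlmostRing

  cyclePoly : ℕ → Poly
  cyclePoly s = X * pathPoly (suc (suc s)) + - (const (+ 2) * (pathPoly (suc s) + 1#))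

  record IsCycleCharMatrix {s} (M : Matrix Poly (suc (suc (suc s)))) : Set where
    field
      entry₀₀ : M zero zero ≈ X
      entry₀₁ : M zero (suc zero) ≈ - 1#
      entry₀-inner : ∀ j → M zero (suc (suc (inject₁ j))) ≈ 0#
      entry₀-last : M zero (suc (suc (fromℕ s))) ≈ - 1#
      column₀ : ∀ i → M (suc i) zero ≈ negFirstLast i
      lowerRight : ∀ i k → M (suc i) (suc k) ≈ pathMatrix i k

  private
    punchIn-fromℕ : ∀ {n} (k : Fin n) → punchIn (fromℕ n) k ≡ inject₁ k
    punchIn-fromℕ zero = refl
    punchIn-fromℕ (suc k) = cong suc (punchIn-fromℕ k)

  module _ {s M} (isCycle : IsCycleCharMatrix {s} M) where

    open IsCycleCharMatrix isCycle

    private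
      last : Fin (suc (suc (suc s)))
      last = suc (suc (fromℕ s))

      cofactorTerm₀ : cofactorTerm M zero ≈ X * pathPoly (suc (suc s))
      cofactorTerm₀ = ≈-trans (scaleP-identity (M zero zero * detP (minor M zero)))
        (mulP-cong entry₀₀ (≈-trans (detP-cong lowerRight) (detP-pathMatrix (suc (suc s)))))

      cofactorTerm₁ : cofactorTerm M (suc zero) ≈ - pathPoly (suc s) + - 1#
      cofactorTerm₁ = begin
        - (M zero (suc zero) * detP (minor M (suc zero)))
          ≈⟨ negP-cong (mulP-cong entry₀₁ (detP-cong-column₀ (minor M (suc zero)) M₁
                                              column₀ λ i k → lowerRight i (suc k))) ⟩
        - (- 1# * detP M₁)
          ≈⟨ -[-1*x]≈x (detP M₁) ⟩
        detP M₁
          ≈⟨ detP-negFirstLast-pathMatrix s ⟩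
        - pathPoly (suc s) + - 1# ∎
        where
        M₁ : Matrix Poly (suc (suc s))
        M₁ = withColumn₀ negFirstLast pathMatrix

      cofactorTermLast : cofactorTerm M last ≈ - (pathPoly (suc s) + 1#)
      cofactorTermLast = begin
        scaleP (sign (toℕ last)) (M zero last * detP (minor M last))
          ≡⟨ cong (λ n → scaleP (sign n) (M zero last * detP (minor M last))) (toℕ-fromℕ s) ⟩
        scaleP (sign s) (M zero last * detP (minor M last))
          ≈⟨ scaleP≈const* (sign s) (M zero last * detP (minor M last)) ⟩
        c * (M zero last * detP (minor M last))
          ≈⟨ mulP-congʳ c (mulP-cong entry₀-last
               (≈-trans (detP-cong-column₀ (minor M last) Mₗ column₀ minorLast≈)
                        (detP-negFirstLast-shiftedPathMatrix s))) ⟩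
        c * (- 1# * (c * (pathPoly (suc s) + 1#)))
          ≈⟨ regroup c (pathPoly (suc s) + 1#) ⟩
        - ((c * c) * (pathPoly (suc s) + 1#))
          ≈⟨ negP-cong (≈-trans (mulP-congˡ (pathPoly (suc s) + 1#) (const-sign² s))
                                (mulP-identityˡ (pathPoly (suc s) + 1#))) ⟩
        - (pathPoly (suc s) + 1#) ∎
        where
        c : Poly
        c = const (sign s)
        Mₗ : Matrix Poly (suc (suc s))
        Mₗ = withColumn₀ negFirstLast shiftedPathMatrix
        minorLast≈ : ∀ i k → minor M last i (suc k) ≈ Mₗ i (suc k)
        minorLast≈ i k = subst (λ j → M (suc i) (suc j) ≈ pathMatrix i (inject₁ k))
                               (sym (punchIn-fromℕ k)) (lowerRight i (inject₁ k))
        regroup : ∀ c y → c * (- 1# * (c * y)) ≈ - ((c * c) * y)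
        regroup = solve-∀ polyAlmostRing

    detP-cycle : detP M ≈ cyclePoly s
    detP-cycle = begin
      cofactorTerm M zero + (cofactorTerm M (suc zero) + sumFinP (λ j → cofactorTerm M (suc (suc j))))
        ≈⟨ addP-congˡ (cofactorTerm M zero) (addP-congˡ (cofactorTerm M (suc zero))
             (sumFinP-last (λ j → cofactorTerm M (suc (suc j))) λ j →
                cofactorTerm-zeroEntry M (suc (suc (inject₁ j))) (entry₀-inner j))) ⟩
      cofactorTerm M zero + (cofactorTerm M (suc zero) + cofactorTerm M last)
        ≈⟨ addP-cong cofactorTerm₀ (addP-cong cofactorTerm₁ cofactorTermLast) ⟩
      X * pathPoly (suc (suc s)) + ((- pathPoly (suc s) + - 1#) + - (pathPoly (suc s) + 1#))
        ≈⟨ identity X (pathPoly (suc (suc s))) (pathPoly (suc s)) ⟩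
      cyclePoly s ∎
      where
      identity : ∀ x p₂ p₁ →
        x * p₂ + ((- p₁ + - 1#) + - (p₁ + 1#)) ≈ x * p₂ + - (const (+ 2) * (p₁ + 1#))
      identity = solve-∀ polyAlmostRing

module FinEquality where

  open import Data.Fin using (Fin; _≟_; _↑ˡ_; _↑ʳ_; splitAt)
  open import Data.Fin.Properties using (splitAt-↑ˡ; splitAt-↑ʳ)
  open import Function.Definitions using (Injective)
  open import Data.Bool using (false)
  open import Relation.Nullary using (yes; no; contradiction)
  open import Relation.Nullary.Decidable using (⌊_⌋)
  open import Relation.Binary.PropositionalEquality

  ⌊≟⌋-injective : ∀ {m n} {f : Fin m → Fin n} → Injective _≡_ _≡_ f →
                  ∀ x y → ⌊ f x ≟ f y ⌋ ≡ ⌊ x ≟ y ⌋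
  ⌊≟⌋-injective {f = f} f-injective x y with x ≟ y | f x ≟ f y
  ... | yes _ | yes _ = refl
  ... | no _ | no _ = refl
  ... | yes refl | no fx≢fx = contradiction refl fx≢fx
  ... | no x≢y | yes fx≡fy = contradiction (f-injective fx≡fy) x≢y

  ⌊≟⌋-≢ : ∀ {n} {x y : Fin n} → x ≢ y → ⌊ x ≟ y ⌋ ≡ false
  ⌊≟⌋-≢ {x = x} {y} x≢y with x ≟ y
  ... | yes x≡y = contradiction x≡y x≢y
  ... | no _ = refl

  ↑ˡ≢↑ʳ : ∀ m {n} (a : Fin m) (b : Fin n) → a ↑ˡ n ≢ m ↑ʳ b
  ↑ˡ≢↑ʳ m {n} a b eq with trans (sym (splitAt-↑ˡ m a n)) (trans (cong (splitAt m) eq) (splitAt-↑ʳ m n b))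
  ... | ()

module DisjointUnion where

  open import Data.Bool using (false)
  open import Data.Fin using (_↑ˡ_; _↑ʳ_)
  open import Data.Fin.Properties using (splitAt-↑ˡ; splitAt-↑ʳ)
  open import Relation.Binary.PropositionalEquality using (_≡_; refl)

  module _ {m n} (G : Graph m) (H : Graph n) where

    ⊕G-↑ˡ-↑ˡ : ∀ a b → (G ⊕G H) (a ↑ˡ n) (b ↑ˡ n) ≡ G a b
    ⊕G-↑ˡ-↑ˡ a b rewrite splitAt-↑ˡ m a n | splitAt-↑ˡ m b n = refl

    ⊕G-↑ʳ-↑ʳ : ∀ a b → (G ⊕G H) (m ↑ʳ a) (m ↑ʳ b) ≡ H a b
    ⊕G-↑ʳ-↑ʳ a b rewrite splitAt-↑ʳ m n a | splitAt-↑ʳ m n b = refl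

    ⊕G-↑ˡ-↑ʳ : ∀ a b → (G ⊕G H) (a ↑ˡ n) (m ↑ʳ b) ≡ false
    ⊕G-↑ˡ-↑ʳ a b rewrite splitAt-↑ˡ m a n | splitAt-↑ʳ m n b = refl

    ⊕G-↑ʳ-↑ˡ : ∀ a b → (G ⊕G H) (m ↑ʳ a) (b ↑ˡ n) ≡ false
    ⊕G-↑ʳ-↑ˡ a b rewrite splitAt-↑ʳ m n a | splitAt-↑ˡ m b n = refl

module RegularWalks where

  open FinEquality
  open DisjointUnion
  open import Data.Nat as ℕ using (ℕ; zero; suc; _^_)
  open import Data.Integer as ℤ using (ℤ; +_; _+_; _*_)
  import Data.Integer.Properties as ℤ
  open import Algebra.Properties.Semiring.Sum ℤ.+-*-semiring
    using (sum; sum-cong-≗; ∑-comm; ∑-distrib-+; *-distribˡ-sum; *-distribʳ-sum)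
  open import Data.Bool using (if_then_else_)
  open import Data.Fin using (Fin; zero; suc; _↑ˡ_; _↑ʳ_; splitAt; join)
  open import Function using (_∘_)
  open import Data.Fin.Properties using (suc-injective; join-splitAt)
  open import Data.Sum using ([_,_])
  open import Relation.Binary.PropositionalEquality
  open ≡-Reasoning

  rowSum : ∀ {n} → Matrix ℤ n → Fin n → ℤ
  rowSum M i = sumFin (M i)

  IsRowRegular : ℕ → ∀ {n} → Matrix ℤ n → Set
  IsRowRegular d M = ∀ i → rowSum M i ≡ + d

  sumFin≡sum : ∀ {n} (f : Fin n → ℤ) → sumFin f ≡ sum f
  sumFin≡sum {zero} f = refl
  sumFin≡sum {suc n} f = cong (_+_ (f zero)) (sumFin≡sum (λ i → f (suc i)))

  sumFin-cong : ∀ {n} {f g : Fin n → ℤ} → (∀ i → f i ≡ g i) → sumFin f ≡ sumFin g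
  sumFin-cong {zero} f≗g = refl
  sumFin-cong {suc n} f≗g = cong₂ _+_ (f≗g zero) (sumFin-cong (λ i → f≗g (suc i)))

  sumFin-+ : ∀ {n} (f g : Fin n → ℤ) → sumFin (λ i → f i + g i) ≡ sumFin f + sumFin g
  sumFin-+ f g = begin
    sumFin (λ i → f i + g i) ≡⟨ sumFin≡sum (λ i → f i + g i) ⟩
    sum (λ i → f i + g i)    ≡⟨ ∑-distrib-+ f g ⟩
    sum f + sum g            ≡⟨ cong₂ _+_ (sumFin≡sum f) (sumFin≡sum g) ⟨
    sumFin f + sumFin g      ∎

  sumFin-zero : ∀ n → sumFin {n} (λ _ → + 0) ≡ + 0
  sumFin-zero zero = refl
  sumFin-zero (suc n) = trans (ℤ.+-identityˡ _) (sumFin-zero n)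

  sumFin-const : ∀ n c → sumFin {n} (λ _ → + c) ≡ + (n ℕ.* c)
  sumFin-const zero c = refl
  sumFin-const (suc n) c = trans (cong (_+_ (+ c)) (sumFin-const n c)) (ℤ.pos-+ c (n ℕ.* c))

  sumFin-↑ : ∀ m n (f : Fin (m ℕ.+ n) → ℤ) →
    sumFin f ≡ sumFin (λ a → f (a ↑ˡ n)) + sumFin (λ b → f (m ↑ʳ b))
  sumFin-↑ zero n f = sym (ℤ.+-identityˡ _)
  sumFin-↑ (suc m) n f =
    trans (cong (_+_ (f zero)) (sumFin-↑ m n (λ i → f (suc i)))) (sym (ℤ.+-assoc (f zero) _ _))

  rowSum-idM : ∀ {n} → IsRowRegular 1 (idM {n})
  rowSum-idM {suc n} zero = cong (_+_ (+ 1)) (sumFin-zero n)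
  rowSum-idM {suc n} (suc i) = begin
    + 0 + sumFin (λ j → idM (suc i) (suc j))
      ≡⟨ ℤ.+-identityˡ _ ⟩
    sumFin (λ j → idM (suc i) (suc j))
      ≡⟨ sumFin-cong (λ j → cong (if_then + 1 else + 0) (⌊≟⌋-injective suc-injective i j)) ⟩
    rowSum idM i
      ≡⟨ rowSum-idM i ⟩
    + 1 ∎

  rowSum-powM : ∀ {d n} {A : Matrix ℤ n} → IsRowRegular d A → ∀ k → IsRowRegular (d ^ k) (powM A k)
  rowSum-powM regular zero = rowSum-idM
  rowSum-powM {d} {A = A} regular (suc k) i = begin
    sumFin (λ j → sumFin (λ l → A i l * powM A k l j))
      ≡⟨ trans (sumFin≡sum (λ j → sumFin (λ l → A i l * powM A k l j)))
               (sum-cong-≗ (λ j → sumFin≡sum (λ l → A i l * powM A k l j))) ⟩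
    sum (λ j → sum (λ l → A i l * powM A k l j))
      ≡⟨ ∑-comm (λ l j → A i l * powM A k l j) ⟨
    sum (λ l → sum (λ j → A i l * powM A k l j))
      ≡⟨ sum-cong-≗ (λ l → *-distribˡ-sum (A i l) (powM A k l)) ⟨
    sum (λ l → A i l * sum (powM A k l))
      ≡⟨ sum-cong-≗ (λ l → cong (A i l *_) (trans (sym (sumFin≡sum (powM A k l))) (rowSum-powM regular k l))) ⟩
    sum (λ l → A i l * + (d ^ k))
      ≡⟨ *-distribʳ-sum (+ (d ^ k)) (A i) ⟨
    sum (A i) * + (d ^ k)
      ≡⟨ cong (_* + (d ^ k)) (trans (sym (sumFin≡sum (A i))) (regular i)) ⟩
    + d * + (d ^ k)
      ≡⟨ ℤ.pos-* d (d ^ k) ⟨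
    + (d ^ suc k) ∎

  onesForm-powM : ∀ {d n} {A : Matrix ℤ n} → IsRowRegular d A → ∀ k → onesForm (powM A k) ≡ + (n ℕ.* d ^ k)
  onesForm-powM {d} {n} regular k = trans (sumFin-cong (rowSum-powM regular k)) (sumFin-const n (d ^ k))

  rowSum-⊕G : ∀ {d m n} (G : Graph m) (H : Graph n) →
    IsRowRegular d (adjMatrix G) → IsRowRegular d (adjMatrix H) → IsRowRegular d (adjMatrix (G ⊕G H))
  rowSum-⊕G {d} {m} {n} G H regularG regularH i =
    subst IsRegularAt (join-splitAt m n i) ([_,_] {C = IsRegularAt ∘ join m n} left right (splitAt m i))
    where
    IsRegularAt : Fin (m ℕ.+ n) → Set
    IsRegularAt i = rowSum (adjMatrix (G ⊕G H)) i ≡ + d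
    left : ∀ a → IsRegularAt (a ↑ˡ n)
    left a = begin
      rowSum (adjMatrix (G ⊕G H)) (a ↑ˡ n)
        ≡⟨ sumFin-↑ m n _ ⟩
      sumFin (λ b → b2ℤ ((G ⊕G H) (a ↑ˡ n) (b ↑ˡ n)))
        + sumFin (λ c → b2ℤ ((G ⊕G H) (a ↑ˡ n) (m ↑ʳ c)))
        ≡⟨ cong₂ _+_ (sumFin-cong λ b → cong b2ℤ (⊕G-↑ˡ-↑ˡ G H a b))
                     (trans (sumFin-cong λ c → cong b2ℤ (⊕G-↑ˡ-↑ʳ G H a c)) (sumFin-zero n)) ⟩
      rowSum (adjMatrix G) a + + 0
        ≡⟨ ℤ.+-identityʳ _ ⟩
      rowSum (adjMatrix G) a
        ≡⟨ regularG a ⟩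
      + d ∎
    right : ∀ b → IsRegularAt (m ↑ʳ b)
    right b = begin
      rowSum (adjMatrix (G ⊕G H)) (m ↑ʳ b)
        ≡⟨ sumFin-↑ m n _ ⟩
      sumFin (λ a → b2ℤ ((G ⊕G H) (m ↑ʳ b) (a ↑ˡ n)))
        + sumFin (λ c → b2ℤ ((G ⊕G H) (m ↑ʳ b) (m ↑ʳ c)))
        ≡⟨ cong₂ _+_ (trans (sumFin-cong λ a → cong b2ℤ (⊕G-↑ʳ-↑ˡ G H b a)) (sumFin-zero m))
                     (sumFin-cong λ c → cong b2ℤ (⊕G-↑ʳ-↑ʳ G H b c)) ⟩
      + 0 + rowSum (adjMatrix H) b
        ≡⟨ ℤ.+-identityˡ _ ⟩
      rowSum (adjMatrix H) b
        ≡⟨ regularH b ⟩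
      + d ∎

module CycleGraph where

  open RegularWalks
  open import Data.Nat as ℕ using (ℕ; zero; suc; _<_; _≤_; _≡ᵇ_; _%_; _≟_; s≤s; z≤n)
  import Data.Nat.Properties as ℕ
  open import Data.Nat.DivMod using (m<n⇒m%n≡m; n%n≡0)
  open import Data.Integer as ℤ using (ℤ; +_; _+_)
  import Data.Integer.Properties as ℤ
  open import Data.Bool using (Bool; true; false; _∨_; T)
  open import Data.Bool.Properties using (∨-identityʳ)
  open import Data.Fin using (Fin; zero; suc; toℕ)
  open import Data.Fin.Properties using (toℕ<n)
  open import Data.Sum using (_⊎_; inj₁; inj₂)
  open import Function using (_∘_)
  open import Relation.Nullary.Decidable using (dec-true; dec-false)
  open import Relation.Binary.PropositionalEquality

  pathAdjacent : ∀ {n} → Fin n → Fin n → Bool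
  pathAdjacent i k = (suc (toℕ i) ≡ᵇ toℕ k) ∨ (suc (toℕ k) ≡ᵇ toℕ i)

  ≡ᵇ-refl : ∀ m → (m ≡ᵇ m) ≡ true
  ≡ᵇ-refl m = dec-true (m ≟ m) refl

  ≢⇒≡ᵇ-false : ∀ {m n} → m ≢ n → (m ≡ᵇ n) ≡ false
  ≢⇒≡ᵇ-false {m} {n} = dec-false (m ≟ n)

  module _ (s : ℕ) where

    private
      N : ℕ
      N = suc (suc (suc s))

      +1-mod-inner : ∀ a → suc a < N → (ℕ._+_ a 1) % N ≡ suc a
      +1-mod-inner a a+1<N = trans (cong (_% N) (ℕ.+-comm a 1)) (m<n⇒m%n≡m a+1<N)

      +1-mod-last : (ℕ._+_ (suc (suc s)) 1) % N ≡ 0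
      +1-mod-last = trans (cong (_% N) (ℕ.+-comm (suc (suc s)) 1)) (n%n≡0 N)

      successor≡ᵇ : ∀ a b → a < suc (suc s) → b < suc (suc s) →
                    ((ℕ._+_ (suc a) 1) % N ≡ᵇ suc b) ≡ (suc a ≡ᵇ b)
      successor≡ᵇ a b a<s+2 b<s+2 with ℕ.m<1+n⇒m<n∨m≡n a<s+2
      ... | inj₁ a<s+1 rewrite +1-mod-inner (suc a) (s≤s (s≤s a<s+1)) = refl
      ... | inj₂ refl rewrite +1-mod-last = sym (≢⇒≡ᵇ-false (ℕ.<⇒≢ b<s+2 ∘ sym))

      wraps≡ᵇ : ∀ a → a < suc s → ((ℕ._+_ (suc (suc a)) 1) % N ≡ᵇ 0) ≡ (a ≡ᵇ s)
      wraps≡ᵇ a a<s+1 with ℕ.m<1+n⇒m<n∨m≡n a<s+1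
      ... | inj₁ a<s rewrite +1-mod-inner (suc (suc a)) (s≤s (s≤s (s≤s a<s))) =
        sym (≢⇒≡ᵇ-false (ℕ.<⇒≢ a<s))
      ... | inj₂ refl rewrite +1-mod-last = sym (≡ᵇ-refl s)

    cycleG-suc-suc : ∀ i k → cycleG N (suc i) (suc k) ≡ pathAdjacent i k
    cycleG-suc-suc i k
      rewrite successor≡ᵇ (toℕ i) (toℕ k) (toℕ<n i) (toℕ<n k)
            | successor≡ᵇ (toℕ k) (toℕ i) (toℕ<n k) (toℕ<n i) = refl

    cycleG-zero-suc-suc : ∀ j → cycleG N zero (suc (suc j)) ≡ (toℕ j ≡ᵇ s)
    cycleG-zero-suc-suc j = wraps≡ᵇ (toℕ j) (toℕ<n j)

    cycleG-suc-suc-zero : ∀ j → cycleG N (suc (suc j)) zero ≡ (toℕ j ≡ᵇ s)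
    cycleG-suc-suc-zero j = trans (∨-identityʳ _) (wraps≡ᵇ (toℕ j) (toℕ<n j))

  count-in : ∀ {m} x → x < m → sumFin {m} (λ k → b2ℤ (x ≡ᵇ toℕ k)) ≡ + 1
  count-in {suc m} zero _ = cong (_+_ (+ 1)) (sumFin-zero m)
  count-in {suc m} (suc x) (s≤s x<m) = trans (ℤ.+-identityˡ _) (count-in x x<m)

  count-out : ∀ {m} x → m ≤ x → sumFin {m} (λ k → b2ℤ (x ≡ᵇ toℕ k)) ≡ + 0
  count-out {zero} x _ = refl
  count-out {suc m} (suc x) (s≤s m≤x) = trans (ℤ.+-identityˡ _) (count-out x m≤x)

  ≡ᵇ-sym : ∀ m n → (m ≡ᵇ n) ≡ (n ≡ᵇ m)
  ≡ᵇ-sym zero zero = refl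
  ≡ᵇ-sym zero (suc n) = refl
  ≡ᵇ-sym (suc m) zero = refl
  ≡ᵇ-sym (suc m) (suc n) = ≡ᵇ-sym m n

  b2ℤ-∨ : ∀ {p q} → (T p → q ≡ false) → b2ℤ (p ∨ q) ≡ b2ℤ p + b2ℤ q
  b2ℤ-∨ {true} p⇒¬q rewrite p⇒¬q _ = refl
  b2ℤ-∨ {false} _ = sym (ℤ.+-identityˡ _)

  cycleG-regular : ∀ s → IsRowRegular 2 (adjMatrix (cycleG (suc (suc (suc s)))))
  cycleG-regular s zero =
    cong (λ c → + 0 + (+ 1 + c))
         (trans (sumFin-cong λ j → cong b2ℤ (trans (cycleG-zero-suc-suc s j) (≡ᵇ-sym (toℕ j) s)))
                (count-in s (ℕ.n<1+n s)))
  cycleG-regular s (suc zero) =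
    cong (_+_ (+ 1))
         (trans (sumFin-cong {suc (suc s)} λ k → cong b2ℤ (trans (cycleG-suc-suc s zero k) (∨-identityʳ _)))
                (count-in {suc (suc s)} 1 (s≤s (s≤s z≤n))))
  -- vertex t + 2 is adjacent to t + 1, to t + 3 when t < s, and to 0 when t = s
  cycleG-regular s (suc (suc t)) = begin
    b2ℤ (cycleG N (suc (suc t)) zero) + sumFin (λ k → b2ℤ (cycleG N (suc (suc t)) (suc k)))
      ≡⟨ cong₂ _+_ (cong b2ℤ (cycleG-suc-suc-zero s t))
                   (sumFin-cong {suc (suc s)} λ k → cong b2ℤ (cycleG-suc-suc s (suc t) k)) ⟩
    b2ℤ (toℕ t ≡ᵇ s) + sumFin (λ k → b2ℤ (pathAdjacent (suc t) k))
      ≡⟨ cong (_+_ (b2ℤ (toℕ t ≡ᵇ s)))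
              (trans (sumFin-cong {suc (suc s)} λ k → b2ℤ-∨ (exclusive k)) (sumFin-+ forward backward)) ⟩
    b2ℤ (toℕ t ≡ᵇ s) + (sumFin forward + sumFin backward)
      ≡⟨ cong (λ c → b2ℤ (toℕ t ≡ᵇ s) + (sumFin forward + c))
              (trans (sumFin-cong {suc (suc s)} λ k → cong b2ℤ (≡ᵇ-sym (toℕ k) (toℕ t)))
                     (count-in (toℕ t) (ℕ.m<n⇒m<1+n (toℕ<n t)))) ⟩
    b2ℤ (toℕ t ≡ᵇ s) + (sumFin forward + + 1)
      ≡⟨ byPosition (ℕ.m<1+n⇒m<n∨m≡n (toℕ<n t)) ⟩
    + 2 ∎
    where
    open ≡-Reasoning
    N : ℕ
    N = suc (suc (suc s))
    forward backward : Fin (suc (suc s)) → ℤ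
    forward k = b2ℤ (suc (suc (toℕ t)) ≡ᵇ toℕ k)
    backward k = b2ℤ (toℕ k ≡ᵇ toℕ t)
    exclusive : ∀ k → T (suc (suc (toℕ t)) ≡ᵇ toℕ k) → (toℕ k ≡ᵇ toℕ t) ≡ false
    exclusive k t+2≡k = ≢⇒≡ᵇ-false {toℕ k} {toℕ t} λ k≡t →
      ℕ.<⇒≢ (ℕ.m<n⇒m<1+n (ℕ.n<1+n (toℕ t))) (trans (sym k≡t) (sym (ℕ.≡ᵇ⇒≡ _ _ t+2≡k)))
    byPosition : (toℕ t < s) ⊎ (toℕ t ≡ s) → b2ℤ (toℕ t ≡ᵇ s) + (sumFin forward + + 1) ≡ + 2
    byPosition (inj₁ t<s)
      rewrite ≢⇒≡ᵇ-false (ℕ.<⇒≢ t<s) | count-in (suc (suc (toℕ t))) (s≤s (s≤s t<s)) = refl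
    byPosition (inj₂ t≡s) rewrite t≡s | ≡ᵇ-refl s | count-out (suc (suc s)) ℕ.≤-refl = refl

module CharMatrix where

  open FinEquality
  open DisjointUnion
  open Polynomial
  open Determinant
  open CycleDeterminant
  open CycleGraph
  open import Data.Nat as ℕ using (ℕ; zero; suc; _≡ᵇ_)
  import Data.Nat.Properties as ℕ
  open import Data.Integer using (+_; -_)
  open import Data.Bool using (Bool; true; false; if_then_else_)
  open import Data.List using ([]; _∷_)
  open import Data.Fin using (Fin; zero; suc; toℕ; inject₁; fromℕ; _≟_; _↑ˡ_; _↑ʳ_)
  open import Data.Fin.Properties
    using (suc-injective; ↑ˡ-injective; ↑ʳ-injective; toℕ<n; toℕ-inject₁; toℕ-fromℕ)
  open import Relation.Nullary.Decidable using (⌊_⌋)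
  open import Function using (_∘_)
  open import Relation.Binary.PropositionalEquality using (_≡_; refl; cong; cong₂; trans; sym; subst)

  charEntry : (onDiagonal adjacent : Bool) → Poly
  charEntry onDiagonal adjacent =
    if onDiagonal then (- b2ℤ adjacent) ∷ + 1 ∷ [] else (- b2ℤ adjacent) ∷ []

  -- x·I − A(G), written so that detP (charMatrix G) unfolds to charPoly (adjMatrix G)
  charMatrix : ∀ {n} → Graph n → Matrix Poly n
  charMatrix G i j = charEntry ⌊ i ≟ j ⌋ (G i j)

  charEntry-false-false : charEntry false false ≈ []
  charEntry-false-false = coeffwise λ { zero → refl ; (suc k) → refl }

  charMatrix-⊕G : ∀ {m n} (G : Graph m) (H : Graph n) →
                  BlockDiagonal (charMatrix (G ⊕G H)) (charMatrix G) (charMatrix H)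
  charMatrix-⊕G {m} {n} G H = record
    { upperLeft = λ a b →
        ≡⇒≈ (cong₂ charEntry (⌊≟⌋-injective (↑ˡ-injective n _ _) a b) (⊕G-↑ˡ-↑ˡ G H a b))
    ; lowerRight = λ a b →
        ≡⇒≈ (cong₂ charEntry (⌊≟⌋-injective (↑ʳ-injective m _ _) a b) (⊕G-↑ʳ-↑ʳ G H a b))
    ; upperRight = λ a b →
        ≈-trans (≡⇒≈ (cong₂ charEntry (⌊≟⌋-≢ (↑ˡ≢↑ʳ m a b)) (⊕G-↑ˡ-↑ʳ G H a b))) charEntry-false-false
    ; lowerLeft = λ a b →
        ≈-trans (≡⇒≈ (cong₂ charEntry (⌊≟⌋-≢ (↑ˡ≢↑ʳ m b a ∘ sym)) (⊕G-↑ʳ-↑ˡ G H a b))) charEntry-false-false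
    }

  pathMatrix≈charEntry : ∀ {n} (i k : Fin n) → pathMatrix i k ≈ charEntry ⌊ i ≟ k ⌋ (pathAdjacent i k)
  pathMatrix≈charEntry zero zero = ≈-refl
  pathMatrix≈charEntry zero (suc zero) = ≈-refl
  pathMatrix≈charEntry zero (suc (suc k)) = ≈-sym charEntry-false-false
  pathMatrix≈charEntry (suc zero) zero = ≈-refl
  pathMatrix≈charEntry (suc (suc i)) zero = ≈-sym charEntry-false-false
  pathMatrix≈charEntry (suc i) (suc k) =
    ≈-trans (pathMatrix≈charEntry i k)
            (≡⇒≈ (cong (λ d → charEntry d (pathAdjacent i k)) (sym (⌊≟⌋-injective suc-injective i k))))

  negLast≈charEntry : ∀ {n} (i : Fin (suc n)) → negLast i ≈ charEntry false (toℕ i ≡ᵇ n)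
  negLast≈charEntry {zero} zero = ≈-refl
  negLast≈charEntry {suc n} zero = ≈-sym charEntry-false-false
  negLast≈charEntry {suc n} (suc i) = negLast≈charEntry i

  charMatrix-cycleG : ∀ s → IsCycleCharMatrix (charMatrix (cycleG (suc (suc (suc s)))))
  charMatrix-cycleG s = record
    { entry₀₀ = ≈-refl
    ; entry₀₁ = ≈-refl
    ; entry₀-inner = entry₀-inner
    ; entry₀-last = ≡⇒≈ (cong (charEntry false) adjacent-last)
    ; column₀ = column₀
    ; lowerRight = lowerRight
    }
    where
    M : Matrix Poly (suc (suc (suc s)))
    M = charMatrix (cycleG (suc (suc (suc s))))
    entry₀-inner : ∀ j → M zero (suc (suc (inject₁ j))) ≈ []
    entry₀-inner j = ≈-trans (≡⇒≈ (cong (charEntry false) (trans (cycleG-zero-suc-suc s (inject₁ j)) j≢s)))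
                             charEntry-false-false
      where
      j≢s : (toℕ (inject₁ j) ≡ᵇ s) ≡ false
      j≢s = ≢⇒≡ᵇ-false (ℕ.<⇒≢ (subst (ℕ._< s) (sym (toℕ-inject₁ j)) (toℕ<n j)))
    adjacent-last : cycleG (suc (suc (suc s))) zero (suc (suc (fromℕ s))) ≡ true
    adjacent-last = trans (cycleG-zero-suc-suc s (fromℕ s)) (trans (cong (_≡ᵇ s) (toℕ-fromℕ s)) (≡ᵇ-refl s))
    column₀ : ∀ i → M (suc i) zero ≈ negFirstLast i
    column₀ zero = ≈-refl
    column₀ (suc i) = ≈-sym (≈-trans (negLast≈charEntry i)
                                     (≡⇒≈ (cong (charEntry false) (sym (cycleG-suc-suc-zero s i)))))
    lowerRight : ∀ i k → M (suc i) (suc k) ≈ pathMatrix i k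
    lowerRight i k = ≈-sym (≈-trans (pathMatrix≈charEntry i k)
      (≡⇒≈ (cong₂ charEntry (sym (⌊≟⌋-injective suc-injective i k)) (sym (cycleG-suc-suc s i k)))))

module VietaLucas where

  open Polynomial
  open CycleDeterminant using (pathPoly; cyclePoly)
  open import Tactic.RingSolver.Core.AlmostCommutativeRing using (AlmostCommutativeRing)
  open AlmostCommutativeRing polyAlmostRing using (_+_; _*_; -_; 1#; setoid)
  open import Tactic.RingSolver using (solve-∀)
  open import Data.Nat as ℕ using (ℕ; zero; suc)
  import Data.Nat.Tactic.RingSolver as ℕ-Solver
  open import Data.Integer using (+_)
  open import Relation.Binary.PropositionalEquality using (_≡_; refl)
  open import Relation.Binary.Reasoning.Setoid setoid

  -- vietaLucas n (t + t⁻¹) = tⁿ + t⁻ⁿ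
  vietaLucas : ℕ → Poly
  vietaLucas zero = const (+ 2)
  vietaLucas (suc zero) = X
  vietaLucas (suc (suc n)) = X * vietaLucas (suc n) + - vietaLucas n

  vietaLucas-pathPoly : ∀ n → vietaLucas (suc (suc n)) ≈ X * pathPoly (suc n) + - (const (+ 2) * pathPoly n)
  vietaLucas-pathPoly zero = identity X
    where
    identity : ∀ x → x * x + - const (+ 2) ≈ x * x + - (const (+ 2) * 1#)
    identity = solve-∀ polyAlmostRing
  vietaLucas-pathPoly (suc zero) = identity X
    where
    identity : ∀ x → x * (x * x + - const (+ 2)) + - x ≈ x * (x * x + - 1#) + - (const (+ 2) * x)
    identity = solve-∀ polyAlmostRing
  vietaLucas-pathPoly (suc (suc n)) = begin
    X * vietaLucas (suc (suc (suc n))) + - vietaLucas (suc (suc n))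
      ≈⟨ addP-cong (mulP-congʳ X (vietaLucas-pathPoly (suc n))) (negP-cong (vietaLucas-pathPoly n)) ⟩
    X * (X * p₂ + - (const (+ 2) * p₁)) + - (X * p₁ + - (const (+ 2) * p₀))
      ≈⟨ identity X p₀ p₁ ⟩
    X * (X * p₂ + - p₁) + - (const (+ 2) * p₂) ∎
    where
    p₀ p₁ p₂ : Poly
    p₀ = pathPoly n
    p₁ = pathPoly (suc n)
    p₂ = X * p₁ + - p₀
    identity : ∀ x p₀ p₁ →
      x * (x * (x * p₁ + - p₀) + - (const (+ 2) * p₁)) + - (x * p₁ + - (const (+ 2) * p₀))
        ≈ x * (x * (x * p₁ + - p₀) + - p₁) + - (const (+ 2) * (x * p₁ + - p₀))
    identity = solve-∀ polyAlmostRing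

  cyclePoly≈vietaLucas : ∀ s → cyclePoly s ≈ vietaLucas (suc (suc (suc s))) + - const (+ 2)
  cyclePoly≈vietaLucas s = begin
    X * pathPoly (suc (suc s)) + - (const (+ 2) * (pathPoly (suc s) + 1#))
      ≈⟨ identity X (pathPoly (suc (suc s))) (pathPoly (suc s)) ⟩
    (X * pathPoly (suc (suc s)) + - (const (+ 2) * pathPoly (suc s))) + - const (+ 2)
      ≈⟨ addP-congʳ (- const (+ 2)) (≈-sym (vietaLucas-pathPoly (suc s))) ⟩
    vietaLucas (suc (suc (suc s))) + - const (+ 2) ∎
    where
    identity : ∀ x p₂ p₁ →
      x * p₂ + - (const (+ 2) * (p₁ + 1#)) ≈ (x * p₂ + - (const (+ 2) * p₁)) + - const (+ 2)
    identity = solve-∀ polyAlmostRing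

  vietaLucas-cong : ∀ {m n} → m ≡ n → vietaLucas m ≈ vietaLucas n
  vietaLucas-cong refl = ≈-refl

  vietaLucas-*-vietaLucas : ∀ a d →
    vietaLucas a * vietaLucas (a ℕ.+ d) ≈ vietaLucas (a ℕ.+ a ℕ.+ d) + vietaLucas d
  vietaLucas-*-vietaLucas zero d = identity (vietaLucas d)
    where
    identity : ∀ u → const (+ 2) * u ≈ u + u
    identity = solve-∀ polyAlmostRing
  vietaLucas-*-vietaLucas (suc zero) d = identity X (vietaLucas (suc d)) (vietaLucas d)
    where
    identity : ∀ x u₁ u₀ → x * u₁ ≈ (x * u₁ + - u₀) + u₀
    identity = solve-∀ polyAlmostRing
  vietaLucas-*-vietaLucas (suc (suc a)) d = begin
    (X * v (suc a) + - v a) * v (suc (suc (a ℕ.+ d)))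
      ≈⟨ distribute X (v (suc a)) (v a) (v (suc (suc (a ℕ.+ d)))) ⟩
    X * (v (suc a) * v (suc (suc (a ℕ.+ d)))) + - (v a * v (suc (suc (a ℕ.+ d))))
      ≈⟨ addP-cong (mulP-congʳ X (≈-trans (mulP-congʳ (v (suc a)) (vietaLucas-cong (index₁ a d)))
                                          (≈-trans (vietaLucas-*-vietaLucas (suc a) (suc d))
                                                   (addP-congʳ (v (suc d)) (vietaLucas-cong (index₂ a d))))))
                   (negP-cong (≈-trans (mulP-congʳ (v a) (vietaLucas-cong (index₃ a d)))
                                       (≈-trans (vietaLucas-*-vietaLucas a (suc (suc d)))
                                                (addP-congʳ (v (suc (suc d))) (vietaLucas-cong (index₄ a d)))))) ⟩
    X * (v (suc (suc (suc t))) + v (suc d)) + - (v (suc (suc t)) + v (suc (suc d)))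
      ≈⟨ regroup X (v (suc (suc (suc t)))) (v (suc (suc t))) (v (suc d)) (v d) ⟩
    v (suc (suc (suc (suc t)))) + v d
      ≈⟨ addP-congʳ (v d) (vietaLucas-cong (index₅ a d)) ⟩
    v (suc (suc a) ℕ.+ suc (suc a) ℕ.+ d) + v d ∎
    where
    v : ℕ → Poly
    v = vietaLucas
    t : ℕ
    t = a ℕ.+ a ℕ.+ d
    distribute : ∀ x u₁ u₀ w → (x * u₁ + - u₀) * w ≈ x * (u₁ * w) + - (u₀ * w)
    distribute = solve-∀ polyAlmostRing
    regroup : ∀ x A B C D → x * (A + C) + - (B + (x * C + - D)) ≈ (x * A + - B) + D
    regroup = solve-∀ polyAlmostRing
    index₁ : ∀ a d → suc (suc (a ℕ.+ d)) ≡ suc a ℕ.+ suc d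
    index₁ = ℕ-Solver.solve-∀
    index₂ : ∀ a d → suc a ℕ.+ suc a ℕ.+ suc d ≡ suc (suc (suc (a ℕ.+ a ℕ.+ d)))
    index₂ = ℕ-Solver.solve-∀
    index₃ : ∀ a d → suc (suc (a ℕ.+ d)) ≡ a ℕ.+ suc (suc d)
    index₃ = ℕ-Solver.solve-∀
    index₄ : ∀ a d → a ℕ.+ a ℕ.+ suc (suc d) ≡ suc (suc (a ℕ.+ a ℕ.+ d))
    index₄ = ℕ-Solver.solve-∀
    index₅ : ∀ a d → suc (suc (suc (suc (a ℕ.+ a ℕ.+ d)))) ≡ suc (suc a) ℕ.+ suc (suc a) ℕ.+ d
    index₅ = ℕ-Solver.solve-∀

module VietaLucasCoefficients where

  open Polynomial
  open VietaLucas
  open import Data.Nat as ℕ using (ℕ; zero; suc; _<_; s≤s)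
  import Data.Nat.Properties as ℕ
  import Data.Nat.Tactic.RingSolver as ℕ-Solver
  open import Data.Integer as ℤ using (ℤ; +_; -_; _-_)
  import Data.Integer.Properties as ℤ
  open import Data.Integer.Tactic.RingSolver using (solve-∀)
  open import Data.List using ([]; _∷_)
  open import Relation.Binary.PropositionalEquality
  open ≡-Reasoning

  -- pascal a b = (a + b choose a)
  pascal : ℕ → ℕ → ℕ
  pascal a zero = 1
  pascal zero (suc b) = 1
  pascal (suc a) (suc b) = pascal a (suc b) ℕ.+ pascal (suc a) b

  coeffP-X*-zero : ∀ p → coeffP (mulP X p) 0 ≡ + 0
  coeffP-X*-zero p = trans (coeffP-mulP-zero (+ 0) (+ 1 ∷ []) p) (ℤ.*-zeroˡ (coeffP p 0))

  coeffP-X*-suc : ∀ p k → coeffP (mulP X p) (suc k) ≡ coeffP p k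
  coeffP-X*-suc p k = begin
    coeffP (mulP X p) (suc k)
      ≡⟨ coeffP-mulP-suc (+ 0) (+ 1 ∷ []) p k ⟩
    + 0 ℤ.* coeffP p (suc k) ℤ.+ coeffP (mulP (+ 1 ∷ []) p) k
      ≡⟨ cong₂ ℤ._+_ (ℤ.*-zeroˡ (coeffP p (suc k))) (mulP-identityˡ p .coeff≡ k) ⟩
    + 0 ℤ.+ coeffP p k
      ≡⟨ ℤ.+-identityˡ (coeffP p k) ⟩
    coeffP p k ∎

  coeffP-vietaLucas-zero : ∀ m → coeffP (vietaLucas (suc (suc m))) 0 ≡ - coeffP (vietaLucas m) 0
  coeffP-vietaLucas-zero m = begin
    coeffP (vietaLucas (suc (suc m))) 0
      ≡⟨ coeffP-addP (mulP X (vietaLucas (suc m))) (negP (vietaLucas m)) 0 ⟩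
    coeffP (mulP X (vietaLucas (suc m))) 0 ℤ.+ coeffP (negP (vietaLucas m)) 0
      ≡⟨ cong₂ ℤ._+_ (coeffP-X*-zero (vietaLucas (suc m))) (coeffP-negP (vietaLucas m) 0) ⟩
    + 0 ℤ.+ - coeffP (vietaLucas m) 0
      ≡⟨ ℤ.+-identityˡ _ ⟩
    - coeffP (vietaLucas m) 0 ∎

  coeffP-vietaLucas-suc : ∀ m k →
    coeffP (vietaLucas (suc (suc m))) (suc k) ≡ coeffP (vietaLucas (suc m)) k - coeffP (vietaLucas m) (suc k)
  coeffP-vietaLucas-suc m k =
    trans (coeffP-addP (mulP X (vietaLucas (suc m))) (negP (vietaLucas m)) (suc k))
          (cong₂ ℤ._+_ (coeffP-X*-suc (vietaLucas (suc m)) k) (coeffP-negP (vietaLucas m) (suc k)))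

  coeffP-vietaLucas-> : ∀ m k → m < k → coeffP (vietaLucas m) k ≡ + 0
  coeffP-vietaLucas-> zero (suc k) _ = refl
  coeffP-vietaLucas-> (suc zero) (suc zero) (s≤s ())
  coeffP-vietaLucas-> (suc zero) (suc (suc k)) _ = refl
  coeffP-vietaLucas-> (suc (suc m)) (suc k) (s≤s m+1<k) = begin
    coeffP (vietaLucas (suc (suc m))) (suc k)
      ≡⟨ coeffP-vietaLucas-suc m k ⟩
    coeffP (vietaLucas (suc m)) k - coeffP (vietaLucas m) (suc k)
      ≡⟨ cong₂ _-_ (coeffP-vietaLucas-> (suc m) k m+1<k)
                   (coeffP-vietaLucas-> m (suc k) (ℕ.m<n⇒m<1+n (ℕ.<-trans (ℕ.n<1+n m) m+1<k))) ⟩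
    + 0 ∎

  coeffP-vietaLucas-leading : ∀ m → coeffP (vietaLucas (suc m)) (suc m) ≡ + 1
  coeffP-vietaLucas-leading zero = refl
  coeffP-vietaLucas-leading (suc m) = begin
    coeffP (vietaLucas (suc (suc m))) (suc (suc m))
      ≡⟨ coeffP-vietaLucas-suc m (suc m) ⟩
    coeffP (vietaLucas (suc m)) (suc m) - coeffP (vietaLucas m) (suc (suc m))
      ≡⟨ cong₂ _-_ (coeffP-vietaLucas-leading m)
                   (coeffP-vietaLucas-> m (suc (suc m)) (ℕ.m<n⇒m<1+n (ℕ.n<1+n m))) ⟩
    + 1 ∎

  coeffP-vietaLucas-odd : ∀ k j → coeffP (vietaLucas (suc (k ℕ.+ (j ℕ.+ j)))) k ≡ + 0
  coeffP-vietaLucas-odd zero zero = refl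
  coeffP-vietaLucas-odd zero (suc j) = begin
    coeffP (vietaLucas (suc (suc j ℕ.+ suc j))) 0
      ≡⟨ cong (λ m → coeffP (vietaLucas (suc m)) 0) (ℕ.+-suc (suc j) j) ⟩
    coeffP (vietaLucas (suc (suc (suc (j ℕ.+ j))))) 0
      ≡⟨ coeffP-vietaLucas-zero (suc (j ℕ.+ j)) ⟩
    - coeffP (vietaLucas (suc (j ℕ.+ j))) 0
      ≡⟨ cong -_ (coeffP-vietaLucas-odd zero j) ⟩
    + 0 ∎
  coeffP-vietaLucas-odd (suc k) j = begin
    coeffP (vietaLucas (suc (suc (k ℕ.+ (j ℕ.+ j))))) (suc k)
      ≡⟨ coeffP-vietaLucas-suc (k ℕ.+ (j ℕ.+ j)) k ⟩
    coeffP (vietaLucas (suc (k ℕ.+ (j ℕ.+ j)))) k - coeffP (vietaLucas (k ℕ.+ (j ℕ.+ j))) (suc k)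
      ≡⟨ cong₂ _-_ (coeffP-vietaLucas-odd k j) (below j) ⟩
    + 0 ∎
    where
    below : ∀ j → coeffP (vietaLucas (k ℕ.+ (j ℕ.+ j))) (suc k) ≡ + 0
    below zero = coeffP-vietaLucas-> (k ℕ.+ 0) (suc k) (s≤s (ℕ.≤-reflexive (ℕ.+-identityʳ k)))
    below (suc j) = trans (cong (λ m → coeffP (vietaLucas m) (suc k)) (index k j)) (coeffP-vietaLucas-odd (suc k) j)
      where
      index : ∀ k j → k ℕ.+ (suc j ℕ.+ suc j) ≡ suc (suc k ℕ.+ (j ℕ.+ j))
      index = ℕ-Solver.solve-∀

  sign-suc : ∀ n → sign (suc n) ≡ - sign n
  sign-suc zero = refl
  sign-suc (suc zero) = refl
  sign-suc (suc (suc n)) = sign-suc n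

  pascal-zeroˡ : ∀ b → pascal 0 b ≡ 1
  pascal-zeroˡ zero = refl
  pascal-zeroˡ (suc b) = refl

  lucasWeight : ℕ → ℕ → ℕ
  lucasWeight k j = pascal k (suc j) ℕ.+ pascal k j

  coeffP-vietaLucas-even : ∀ k j →
    coeffP (vietaLucas (k ℕ.+ (suc j ℕ.+ suc j))) k ≡ sign (suc j) ℤ.* + lucasWeight k j
  coeffP-vietaLucas-even zero zero = refl
  coeffP-vietaLucas-even zero (suc j) = begin
    coeffP (vietaLucas (suc (suc j) ℕ.+ suc (suc j))) 0
      ≡⟨ cong (λ m → coeffP (vietaLucas (suc m)) 0) (ℕ.+-suc (suc j) (suc j)) ⟩
    coeffP (vietaLucas (suc (suc (suc j ℕ.+ suc j)))) 0
      ≡⟨ coeffP-vietaLucas-zero (suc j ℕ.+ suc j) ⟩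
    - coeffP (vietaLucas (suc j ℕ.+ suc j)) 0
      ≡⟨ cong -_ (coeffP-vietaLucas-even zero j) ⟩
    - (sign (suc j) ℤ.* + lucasWeight 0 j)
      ≡⟨ cong (λ w → - (sign (suc j) ℤ.* + w)) (weight₀ j) ⟩
    - (sign (suc j) ℤ.* + 2)
      ≡⟨ cong (λ σ → - (σ ℤ.* + 2)) (sign-suc j) ⟩
    - (- sign j ℤ.* + 2)
      ≡⟨ negate (sign j) ⟩
    sign j ℤ.* + 2
      ≡⟨ cong (λ w → sign j ℤ.* + w) (weight₀ (suc j)) ⟨
    sign (suc (suc j)) ℤ.* + lucasWeight 0 (suc j) ∎
    where
    weight₀ : ∀ j → lucasWeight 0 j ≡ 2
    weight₀ j = cong₂ ℕ._+_ (pascal-zeroˡ (suc j)) (pascal-zeroˡ j)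
    negate : ∀ σ → - (- σ ℤ.* + 2) ≡ σ ℤ.* + 2
    negate = solve-∀
  coeffP-vietaLucas-even (suc k) j = begin
    coeffP (vietaLucas (suc k ℕ.+ (suc j ℕ.+ suc j))) (suc k)
      ≡⟨ cong (λ m → coeffP (vietaLucas m) (suc k)) (index k j) ⟩
    coeffP (vietaLucas (suc (suc (suc (k ℕ.+ (j ℕ.+ j)))))) (suc k)
      ≡⟨ coeffP-vietaLucas-suc (suc (k ℕ.+ (j ℕ.+ j))) k ⟩
    coeffP (vietaLucas (suc (suc (k ℕ.+ (j ℕ.+ j))))) k - coeffP (vietaLucas (suc (k ℕ.+ (j ℕ.+ j)))) (suc k)
      ≡⟨ cong₂ _-_ (trans (cong (λ m → coeffP (vietaLucas m) k) (shift k j)) (coeffP-vietaLucas-even k j))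
                   (below j) ⟩
    sign (suc j) ℤ.* + lucasWeight k j - previous j
      ≡⟨ pascalStep j ⟩
    sign (suc j) ℤ.* + lucasWeight (suc k) j ∎
    where
    index : ∀ k j → suc k ℕ.+ (suc j ℕ.+ suc j) ≡ suc (suc (suc (k ℕ.+ (j ℕ.+ j))))
    index = ℕ-Solver.solve-∀
    shift : ∀ k j → suc (suc (k ℕ.+ (j ℕ.+ j))) ≡ k ℕ.+ (suc j ℕ.+ suc j)
    shift = ℕ-Solver.solve-∀
    previous : ℕ → ℤ
    previous zero = + 1
    previous (suc j) = sign (suc j) ℤ.* + lucasWeight (suc k) j
    below : ∀ j → coeffP (vietaLucas (suc (k ℕ.+ (j ℕ.+ j)))) (suc k) ≡ previous j
    below zero = trans (cong (λ m → coeffP (vietaLucas (suc m)) (suc k)) (ℕ.+-identityʳ k))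
                       (coeffP-vietaLucas-leading k)
    below (suc j) = coeffP-vietaLucas-even (suc k) j
    pascalStep : ∀ j → sign (suc j) ℤ.* + lucasWeight k j - previous j ≡ sign (suc j) ℤ.* + lucasWeight (suc k) j
    pascalStep zero = identity (+ pascal k 1)
      where
      identity : ∀ x → - + 1 ℤ.* (x ℤ.+ + 1) - + 1 ≡ - + 1 ℤ.* ((x ℤ.+ + 1) ℤ.+ + 1)
      identity = solve-∀
    pascalStep (suc j) = begin
      σ ℤ.* + lucasWeight k (suc j) - sign (suc j) ℤ.* + lucasWeight (suc k) j
        ≡⟨ cong (λ τ → σ ℤ.* + lucasWeight k (suc j) - τ ℤ.* + lucasWeight (suc k) j) (sign-suc j) ⟩
      σ ℤ.* + lucasWeight k (suc j) - (- sign j) ℤ.* + lucasWeight (suc k) j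
        ≡⟨ identity σ (+ pascal k (suc (suc j))) (+ pascal k (suc j))
                      (+ pascal (suc k) (suc j)) (+ pascal (suc k) j) ⟩
      σ ℤ.* + lucasWeight (suc k) (suc j) ∎
      where
      σ : ℤ
      σ = sign (suc (suc j))
      identity : ∀ σ a b c d → σ ℤ.* (a ℤ.+ b) - (- σ) ℤ.* (c ℤ.+ d) ≡ σ ℤ.* ((a ℤ.+ c) ℤ.+ (b ℤ.+ d))
      identity = solve-∀

  pascal-oneʳ : ∀ a → pascal a 1 ≡ suc a
  pascal-oneʳ zero = refl
  pascal-oneʳ (suc a) = trans (cong (ℕ._+ 1) (pascal-oneʳ a)) (ℕ.+-comm (suc a) 1)

  pascal-absorption : ∀ a b → suc b ℕ.* pascal a (suc b) ≡ (a ℕ.+ suc b) ℕ.* pascal a b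
  pascal-absorption zero b rewrite pascal-zeroˡ b = refl
  pascal-absorption (suc a) zero rewrite pascal-oneʳ a = identity a
    where
    identity : ∀ a → 1 ℕ.* (suc a ℕ.+ 1) ≡ (suc a ℕ.+ 1) ℕ.* 1
    identity = ℕ-Solver.solve-∀
  pascal-absorption (suc a) (suc b) = begin
    suc (suc b) ℕ.* (pascal a (suc (suc b)) ℕ.+ pascal (suc a) (suc b))
      ≡⟨ ℕ.*-distribˡ-+ (suc (suc b)) (pascal a (suc (suc b))) (pascal (suc a) (suc b)) ⟩
    suc (suc b) ℕ.* pascal a (suc (suc b)) ℕ.+ suc (suc b) ℕ.* pascal (suc a) (suc b)
      ≡⟨ cong₂ ℕ._+_ (pascal-absorption a (suc b)) (peel b (pascal (suc a) (suc b))) ⟩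
    (a ℕ.+ suc (suc b)) ℕ.* pascal a (suc b) ℕ.+ (suc b ℕ.* pascal (suc a) (suc b) ℕ.+ pascal (suc a) (suc b))
      ≡⟨ cong (λ x → (a ℕ.+ suc (suc b)) ℕ.* pascal a (suc b) ℕ.+ (x ℕ.+ pascal (suc a) (suc b)))
              (pascal-absorption (suc a) b) ⟩
    (a ℕ.+ suc (suc b)) ℕ.* pascal a (suc b) ℕ.+ ((suc a ℕ.+ suc b) ℕ.* pascal (suc a) b ℕ.+ pascal (suc a) (suc b))
      ≡⟨ regroup a b (pascal a (suc b)) (pascal (suc a) b) ⟩
    (suc a ℕ.+ suc (suc b)) ℕ.* (pascal a (suc b) ℕ.+ pascal (suc a) b) ∎
    where
    peel : ∀ b x → suc (suc b) ℕ.* x ≡ suc b ℕ.* x ℕ.+ x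
    peel = ℕ-Solver.solve-∀
    regroup : ∀ a b x y → (a ℕ.+ suc (suc b)) ℕ.* x ℕ.+ ((suc a ℕ.+ suc b) ℕ.* y ℕ.+ (x ℕ.+ y))
                          ≡ (suc a ℕ.+ suc (suc b)) ℕ.* (x ℕ.+ y)
    regroup = ℕ-Solver.solve-∀

  suc*lucasWeight : ∀ k j → suc j ℕ.* lucasWeight k j ≡ (k ℕ.+ (suc j ℕ.+ suc j)) ℕ.* pascal k j
  suc*lucasWeight k j = begin
    suc j ℕ.* (pascal k (suc j) ℕ.+ pascal k j)
      ≡⟨ ℕ.*-distribˡ-+ (suc j) (pascal k (suc j)) (pascal k j) ⟩
    suc j ℕ.* pascal k (suc j) ℕ.+ suc j ℕ.* pascal k j
      ≡⟨ cong (ℕ._+ suc j ℕ.* pascal k j) (pascal-absorption k j) ⟩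
    (k ℕ.+ suc j) ℕ.* pascal k j ℕ.+ suc j ℕ.* pascal k j
      ≡⟨ ℕ.*-distribʳ-+ (pascal k j) (k ℕ.+ suc j) (suc j) ⟨
    (k ℕ.+ suc j ℕ.+ suc j) ℕ.* pascal k j
      ≡⟨ cong (ℕ._* pascal k j) (ℕ.+-assoc k (suc j) (suc j)) ⟩
    (k ℕ.+ (suc j ℕ.+ suc j)) ℕ.* pascal k j ∎

module VietaLucasDivisibility where

  open VietaLucas
  open VietaLucasCoefficients
  open import Data.Nat as ℕ using (ℕ; zero; suc; _+_; _*_; _^_; _∸_; _≤_; _!)
  import Data.Nat.Properties as ℕ
  open import Data.Nat.Divisibility as ℕ using (m≤n⇒m!∣n!; m∣m*n; *-monoʳ-∣; *-cancelˡ-∣; divides; _∣0)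
  open import Data.Integer as ℤ using (+_)
  open import Data.Integer.Divisibility.Signed as ℤ using (∣ᵤ⇒∣; ∣n⇒∣m*n)
  open import Data.Product using (Σ-syntax; _,_)
  open import Data.Sum using (_⊎_; inj₁; inj₂)
  open import Relation.Binary.PropositionalEquality

  ^-monoʳ-∣ : ∀ b {m n} → m ≤ n → b ^ m ℕ.∣ b ^ n
  ^-monoʳ-∣ b {m} {n} m≤n = divides (b ^ (n ∸ m)) (begin
    b ^ n                 ≡⟨ cong (b ^_) (ℕ.m+[n∸m]≡n m≤n) ⟨
    b ^ (m + (n ∸ m))     ≡⟨ ℕ.^-distribˡ-+-* b m (n ∸ m) ⟩
    b ^ m * b ^ (n ∸ m)   ≡⟨ ℕ.*-comm (b ^ m) (b ^ (n ∸ m)) ⟩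
    b ^ (n ∸ m) * b ^ m   ∎)
    where open ≡-Reasoning

  twiceOrSuc : ∀ m → (Σ[ j ∈ ℕ ] m ≡ j + j) ⊎ (Σ[ j ∈ ℕ ] m ≡ suc (j + j))
  twiceOrSuc zero = inj₁ (0 , refl)
  twiceOrSuc (suc m) with twiceOrSuc m
  ... | inj₁ (j , refl) = inj₂ (j , refl)
  ... | inj₂ (j , refl) = inj₁ (suc j , cong suc (sym (ℕ.+-suc j j)))

  lucasWeight-divisible : ∀ a k j → suc j ≤ suc a → k + (suc j + suc j) ≡ 2 ^ suc a * suc a ! →
                          2 ^ suc a ℕ.∣ lucasWeight k j
  lucasWeight-divisible a k j j+1≤a+1 k+2j+2≡n = *-cancelˡ-∣ (suc j) (begin
    suc j * 2 ^ suc a                   ≡⟨ ℕ.*-comm (suc j) (2 ^ suc a) ⟩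
    2 ^ suc a * suc j                   ∣⟨ *-monoʳ-∣ (2 ^ suc a) (ℕ.∣-trans (m∣m*n (j !)) (m≤n⇒m!∣n! j+1≤a+1)) ⟩
    2 ^ suc a * suc a !                 ∣⟨ m∣m*n (pascal k j) ⟩
    2 ^ suc a * suc a ! * pascal k j    ≡⟨ cong (_* pascal k j) k+2j+2≡n ⟨
    (k + (suc j + suc j)) * pascal k j  ≡⟨ suc*lucasWeight k j ⟨
    suc j * lucasWeight k j             ∎)
    where open ℕ.∣-Reasoning

  coeffP-vietaLucas-divisible : ∀ a k κ → 1 ≤ κ → κ ≤ suc a → 2 ^ suc a * suc a ! ≡ k + κ →
                                + (2 ^ suc a) ℤ.∣ coeffP (vietaLucas (2 ^ suc a * suc a !)) k
  coeffP-vietaLucas-divisible a k (suc κ) _ κ+1≤a+1 n≡k+κ+1 with twiceOrSuc κ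
  ... | inj₁ (j , refl) = subst (+ (2 ^ suc a) ℤ.∣_) (sym coefficient≡0) (∣ᵤ⇒∣ (_∣0 (2 ^ suc a)))
    where
    coefficient≡0 : coeffP (vietaLucas (2 ^ suc a * suc a !)) k ≡ + 0
    coefficient≡0 = trans (cong (λ m → coeffP (vietaLucas m) k) (trans n≡k+κ+1 (ℕ.+-suc k (j + j))))
                          (coeffP-vietaLucas-odd k j)
  ... | inj₂ (j , refl) = subst (+ (2 ^ suc a) ℤ.∣_) (sym coefficient≡)
                                (∣n⇒∣m*n (sign (suc j)) (∣ᵤ⇒∣ (lucasWeight-divisible a k j j+1≤a+1 (sym n≡k+2j+2))))
    where
    n≡k+2j+2 : 2 ^ suc a * suc a ! ≡ k + (suc j + suc j)
    n≡k+2j+2 = trans n≡k+κ+1 (cong (λ m → k + suc m) (sym (ℕ.+-suc j j)))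
    j+1≤a+1 : suc j ≤ suc a
    j+1≤a+1 = ℕ.≤-trans (ℕ.m≤m+n (suc j) (suc j)) (subst (_≤ suc a) (cong suc (sym (ℕ.+-suc j j))) κ+1≤a+1)
    coefficient≡ : coeffP (vietaLucas (2 ^ suc a * suc a !)) k ≡ sign (suc j) ℤ.* + lucasWeight k j
    coefficient≡ = trans (cong (λ m → coeffP (vietaLucas m) k) n≡k+2j+2) (coeffP-vietaLucas-even k j)

module Degree where

  open import Data.Nat using (ℕ; zero; suc; _<_; _∸_; s≤s; z≤n)
  open import Data.Integer using (ℤ; +_; -[1+_])
  open import Data.List using (List; []; _∷_; _++_; _ʳ++_; reverse; length)
  open import Data.List.Properties using (++-ʳ++; length-reverse)
  open import Data.List.Relation.Unary.All using (All; []; _∷_)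
  open import Relation.Nullary using (contradiction)
  open import Relation.Binary.PropositionalEquality
  open ≡-Reasoning

  record SplitAtTop (p : Poly) (d : ℕ) : Set where
    field
      lower : List ℤ
      top : ℤ
      upper : List ℤ
      p≡ : p ≡ lower ++ top ∷ upper
      length-lower : length lower ≡ d
      top≢0 : top ≢ + 0
      upper≡0 : All (_≡ + 0) upper

  splitAtTop : ∀ p d → coeffP p d ≢ + 0 → (∀ k → d < k → coeffP p k ≡ + 0) → SplitAtTop p d
  splitAtTop [] d p[d]≢0 _ = contradiction refl p[d]≢0
  splitAtTop (b ∷ p) zero b≢0 above≡0 = record
    { lower = [] ; top = b ; upper = p ; p≡ = refl ; length-lower = refl ; top≢0 = b≢0
    ; upper≡0 = all≡0 p λ k → above≡0 (suc k) (s≤s z≤n) }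
    where
    all≡0 : ∀ zs → (∀ k → coeffP zs k ≡ + 0) → All (_≡ + 0) zs
    all≡0 [] _ = []
    all≡0 (z ∷ zs) zs≡0 = zs≡0 0 ∷ all≡0 zs (λ k → zs≡0 (suc k))
  splitAtTop (b ∷ p) (suc d) p[d]≢0 above≡0 = record
    { lower = b ∷ lower ; top = top ; upper = upper ; p≡ = cong (b ∷_) p≡
    ; length-lower = cong suc length-lower ; top≢0 = top≢0 ; upper≡0 = upper≡0 }
    where open SplitAtTop (splitAtTop p d p[d]≢0 λ k d<k → above≡0 (suc k) (s≤s d<k))

  dropZerosRev-ʳ++ : ∀ {zs} l → All (_≡ + 0) zs → dropZerosRev (zs ʳ++ l) ≡ dropZerosRev l
  dropZerosRev-ʳ++ l [] = refl
  dropZerosRev-ʳ++ l (refl ∷ zs≡0) = dropZerosRev-ʳ++ (+ 0 ∷ l) zs≡0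

  dropZerosRev-∷ : ∀ {a} l → a ≢ + 0 → dropZerosRev (a ∷ l) ≡ a ∷ l
  dropZerosRev-∷ {+ zero} l a≢0 = contradiction refl a≢0
  dropZerosRev-∷ {+ suc n} l a≢0 = refl
  dropZerosRev-∷ { -[1+ n ]} l a≢0 = refl

  degP-≡ : ∀ p d → coeffP p d ≢ + 0 → (∀ k → d < k → coeffP p k ≡ + 0) → degP p ≡ d
  degP-≡ p d p[d]≢0 above≡0 = begin
    length (reverse (dropZerosRev (reverse p))) ∸ 1
      ≡⟨ cong (λ q → length (reverse (dropZerosRev q)) ∸ 1) reverse-p ⟩
    length (reverse (dropZerosRev (upper ʳ++ (top ∷ reverse lower)))) ∸ 1
      ≡⟨ cong (λ q → length (reverse q) ∸ 1)
              (trans (dropZerosRev-ʳ++ (top ∷ reverse lower) upper≡0) (dropZerosRev-∷ (reverse lower) top≢0)) ⟩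
    length (reverse (top ∷ reverse lower)) ∸ 1
      ≡⟨ cong (_∸ 1) (length-reverse (top ∷ reverse lower)) ⟩
    length (reverse lower)
      ≡⟨ trans (length-reverse lower) length-lower ⟩
    d ∎
    where
    open SplitAtTop (splitAtTop p d p[d]≢0 above≡0)
    reverse-p : reverse p ≡ upper ʳ++ (top ∷ reverse lower)
    reverse-p = trans (cong reverse p≡) (++-ʳ++ lower)

module CycleUnion where

  open Polynomial
  open Determinant
  open CycleDeterminant
  open CharMatrix
  open VietaLucas
  open VietaLucasCoefficients
  open VietaLucasDivisibility
  open Degree
  open RegularWalks
  open CycleGraph
  open import Tactic.RingSolver.Core.AlmostCommutativeRing using (AlmostCommutativeRing)
  open AlmostCommutativeRing polyAlmostRing using (_+_; _*_; -_; setoid)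
  open import Tactic.RingSolver using (solve-∀)
  open import Data.Nat as ℕ using (ℕ; zero; suc; _^_; _∸_; _<_; _≤_; _!; s≤s; z≤n)
  import Data.Nat.Properties as ℕ
  import Data.Nat.Tactic.RingSolver as ℕ-Solver
  open import Data.Integer as ℤ using (ℤ; +_)
  import Data.Integer.Properties as ℤ
  import Data.Integer.Tactic.RingSolver as ℤ-Solver
  open import Data.Nat.Divisibility as ℕ using (m∣m*n)
  open import Data.Integer.Divisibility using (_∣_)
  open import Data.Integer.Divisibility.Signed as ℤ using (∣⇒∣ᵤ)
  open import Relation.Binary.PropositionalEquality using (_≡_; _≢_; sym; trans; cong; cong₂; subst; subst₂)
  import Relation.Binary.PropositionalEquality as ≡
  open import Relation.Nullary using (contradiction)
  open import Data.Product using (Σ-syntax; _,_)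

  charPoly-⊕G : ∀ {m n} (G : Graph m) (H : Graph n) →
                charPoly (adjMatrix (G ⊕G H)) ≈ charPoly (adjMatrix G) * charPoly (adjMatrix H)
  charPoly-⊕G G H = detP-blockDiagonal (charMatrix-⊕G G H)

  charPoly-cycleG : ∀ s → charPoly (adjMatrix (cycleG (suc (suc (suc s)))))
                          ≈ vietaLucas (suc (suc (suc s))) + - const (+ 2)
  charPoly-cycleG s = ≈-trans (detP-cycle (charMatrix-cycleG s)) (cyclePoly≈vietaLucas s)

  module _ (s d : ℕ) where

    private
      a : ℕ
      a = suc (suc (suc s))
      v : ℕ → Poly
      v = vietaLucas
      c₂ : Poly
      c₂ = const (+ 2)

    charPoly-cycleG⊕cycleG :
      charPoly (adjMatrix (cycleG a ⊕G cycleG (a ℕ.+ d)))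
        ≈ v (a ℕ.+ a ℕ.+ d) + (v d + (- (c₂ * v a) + (- (c₂ * v (a ℕ.+ d)) + const (+ 4))))
    charPoly-cycleG⊕cycleG = begin
      charPoly (adjMatrix (cycleG a ⊕G cycleG (a ℕ.+ d)))
        ≈⟨ charPoly-⊕G (cycleG a) (cycleG (a ℕ.+ d)) ⟩
      charPoly (adjMatrix (cycleG a)) * charPoly (adjMatrix (cycleG (a ℕ.+ d)))
        ≈⟨ mulP-cong (charPoly-cycleG s) (charPoly-cycleG (s ℕ.+ d)) ⟩
      (v a + - c₂) * (v (a ℕ.+ d) + - c₂)
        ≈⟨ expand (v a) (v (a ℕ.+ d)) ⟩
      v a * v (a ℕ.+ d) + (- (c₂ * v a) + (- (c₂ * v (a ℕ.+ d)) + const (+ 4)))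
        ≈⟨ addP-congʳ _ (vietaLucas-*-vietaLucas a d) ⟩
      (v (a ℕ.+ a ℕ.+ d) + v d) + (- (c₂ * v a) + (- (c₂ * v (a ℕ.+ d)) + const (+ 4)))
        ≈⟨ addP-assoc (v (a ℕ.+ a ℕ.+ d)) (v d) _ ⟩
      v (a ℕ.+ a ℕ.+ d) + (v d + (- (c₂ * v a) + (- (c₂ * v (a ℕ.+ d)) + const (+ 4)))) ∎
      where
      open import Relation.Binary.Reasoning.Setoid setoid
      expand : ∀ x y → (x + - const (+ 2)) * (y + - const (+ 2))
                        ≈ x * y + (- (const (+ 2) * x) + (- (const (+ 2) * y) + const (+ 4)))
      expand = solve-∀ polyAlmostRing

    coeffP-charPoly-cycleG⊕cycleG : ∀ k → a < k → d < k →
      coeffP (charPoly (adjMatrix (cycleG a ⊕G cycleG (a ℕ.+ d)))) k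
        ≡ coeffP (v (a ℕ.+ a ℕ.+ d)) k ℤ.- + 2 ℤ.* coeffP (v (a ℕ.+ d)) k
    coeffP-charPoly-cycleG⊕cycleG (suc k) a<k+1 d<k+1 = begin
      coeffP (charPoly (adjMatrix (cycleG a ⊕G cycleG (a ℕ.+ d)))) (suc k)
        ≡⟨ charPoly-cycleG⊕cycleG .coeff≡ (suc k) ⟩
      coeffP (v n + (v d + (- (c₂ * v a) + (- (c₂ * v (a ℕ.+ d)) + const (+ 4))))) (suc k)
        ≡⟨ coeffP-addP (v n) _ (suc k) ⟩
      [ v n ] ℤ.+ coeffP (v d + (- (c₂ * v a) + (- (c₂ * v (a ℕ.+ d)) + const (+ 4)))) (suc k)
        ≡⟨ cong (ℤ._+_ [ v n ]) (coeffP-addP (v d) _ (suc k)) ⟩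
      [ v n ] ℤ.+ ([ v d ] ℤ.+ coeffP (- (c₂ * v a) + (- (c₂ * v (a ℕ.+ d)) + const (+ 4))) (suc k))
        ≡⟨ cong (λ x → [ v n ] ℤ.+ ([ v d ] ℤ.+ x))
                (trans (coeffP-addP (- (c₂ * v a)) _ (suc k))
                       (cong₂ ℤ._+_ (coeffP-negP (c₂ * v a) (suc k))
                                    (trans (coeffP-addP (- (c₂ * v (a ℕ.+ d))) (const (+ 4)) (suc k))
                                           (cong (ℤ._+ + 0) (coeffP-negP (c₂ * v (a ℕ.+ d)) (suc k)))))) ⟩
      [ v n ] ℤ.+ ([ v d ] ℤ.+ (ℤ.- [ c₂ * v a ] ℤ.+ (ℤ.- [ c₂ * v (a ℕ.+ d) ] ℤ.+ + 0)))
        ≡⟨ cong₂ (λ x y → [ v n ] ℤ.+ (x ℤ.+ (ℤ.- y ℤ.+ (ℤ.- [ c₂ * v (a ℕ.+ d) ] ℤ.+ + 0))))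
                 (coeffP-vietaLucas-> d (suc k) d<k+1)
                 (trans (coeffP-const* (+ 2) (v a) (suc k)) (cong (+ 2 ℤ.*_) (coeffP-vietaLucas-> a (suc k) a<k+1))) ⟩
      [ v n ] ℤ.+ (+ 0 ℤ.+ (ℤ.- (+ 2 ℤ.* + 0) ℤ.+ (ℤ.- [ c₂ * v (a ℕ.+ d) ] ℤ.+ + 0)))
        ≡⟨ cong (λ y → [ v n ] ℤ.+ (+ 0 ℤ.+ (ℤ.- (+ 2 ℤ.* + 0) ℤ.+ (ℤ.- y ℤ.+ + 0))))
                (coeffP-const* (+ 2) (v (a ℕ.+ d)) (suc k)) ⟩
      [ v n ] ℤ.+ (+ 0 ℤ.+ (ℤ.- (+ 2 ℤ.* + 0) ℤ.+ (ℤ.- (+ 2 ℤ.* [ v (a ℕ.+ d) ]) ℤ.+ + 0)))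
        ≡⟨ simplify [ v n ] [ v (a ℕ.+ d) ] ⟩
      [ v n ] ℤ.- + 2 ℤ.* [ v (a ℕ.+ d) ] ∎
      where
      open ≡.≡-Reasoning
      n : ℕ
      n = a ℕ.+ a ℕ.+ d
      [_] : Poly → ℤ
      [ p ] = coeffP p (suc k)
      simplify : ∀ x y → x ℤ.+ (+ 0 ℤ.+ (ℤ.- (+ 2 ℤ.* + 0) ℤ.+ (ℤ.- (+ 2 ℤ.* y) ℤ.+ + 0))) ≡ x ℤ.- + 2 ℤ.* y
      simplify = ℤ-Solver.solve-∀

  module _ (s e : ℕ) where

    private
      a d n : ℕ
      a = suc (suc (suc s))
      d = suc (suc e)
      n = a ℕ.+ a ℕ.+ d
      v : ℕ → Poly
      v = vietaLucas
      A : Poly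
      A = charPoly (adjMatrix (cycleG a ⊕G cycleG (a ℕ.+ d)))

      a+d≡ : a ℕ.+ d ≡ suc (suc (a ℕ.+ e))
      a+d≡ = trans (ℕ.+-suc a (suc e)) (cong suc (ℕ.+-suc a e))

      a<a+d : a < a ℕ.+ d
      a<a+d = ℕ.m<m+n a (s≤s z≤n)

      a+d<n : a ℕ.+ d < n
      a+d<n = subst (a ℕ.+ d <_) (sym (ℕ.+-assoc a a d)) (ℕ.m<n+m (a ℕ.+ d) {a} (s≤s z≤n))

      d<a+d : d < a ℕ.+ d
      d<a+d = ℕ.m<n+m d {a} (s≤s z≤n)

    degP-charPoly-cycleG⊕cycleG : degP A ≡ n
    degP-charPoly-cycleG⊕cycleG = degP-≡ A n leading≢0 above≡0
      where
      coefficient : ∀ k → n ℕ.≤ k → coeffP A k ≡ coeffP (v n) k ℤ.- + 2 ℤ.* + 0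
      coefficient k n≤k = trans (coeffP-charPoly-cycleG⊕cycleG s d k a<k d<k)
                                (cong (λ y → coeffP (v n) k ℤ.- + 2 ℤ.* y) (coeffP-vietaLucas-> (a ℕ.+ d) k a+d<k))
        where
        a+d<k : a ℕ.+ d < k
        a+d<k = ℕ.<-≤-trans a+d<n n≤k
        a<k : a < k
        a<k = ℕ.<-trans a<a+d a+d<k
        d<k : d < k
        d<k = ℕ.<-trans d<a+d a+d<k
      leading≢0 : coeffP A n ≢ + 0
      leading≢0 A[n]≡0 = contradiction (trans (sym leading) A[n]≡0) λ ()
        where
        leading : coeffP A n ≡ + 1
        leading = trans (coefficient n ℕ.≤-refl) (cong (ℤ._- + 0) (coeffP-vietaLucas-leading (ℕ.pred n)))
      above≡0 : ∀ k → n < k → coeffP A k ≡ + 0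
      above≡0 k n<k = trans (coefficient k (ℕ.<⇒≤ n<k)) (cong (ℤ._- + 0) (coeffP-vietaLucas-> n k n<k))

    -- for κ + r ≡ 1 + a this is deg A ∸ κ, the index of the coefficient c_κ
    topIndex : ℕ → ℕ
    topIndex r = suc (r ℕ.+ (a ℕ.+ e))

    n≡topIndex+κ : ∀ κ r → κ ℕ.+ r ≡ suc a → n ≡ topIndex r ℕ.+ κ
    n≡topIndex+κ κ r κ+r≡a+1 = begin
      a ℕ.+ a ℕ.+ d                ≡⟨ regroup₁ a e ⟩
      suc a ℕ.+ suc (a ℕ.+ e)      ≡⟨ cong (ℕ._+ suc (a ℕ.+ e)) κ+r≡a+1 ⟨
      κ ℕ.+ r ℕ.+ suc (a ℕ.+ e)    ≡⟨ regroup₂ κ r (a ℕ.+ e) ⟩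
      topIndex r ℕ.+ κ             ∎
      where
      open ≡.≡-Reasoning
      regroup₁ : ∀ a e → a ℕ.+ a ℕ.+ suc (suc e) ≡ suc a ℕ.+ suc (a ℕ.+ e)
      regroup₁ = ℕ-Solver.solve-∀
      regroup₂ : ∀ κ r m → κ ℕ.+ r ℕ.+ suc m ≡ suc (r ℕ.+ m) ℕ.+ κ
      regroup₂ = ℕ-Solver.solve-∀

    c-charPoly-cycleG⊕cycleG : ∀ κ r → κ ℕ.+ r ≡ suc a →
      c_ κ A ≡ coeffP (v n) (topIndex r) ℤ.- + 2 ℤ.* coeffP (v (a ℕ.+ d)) (topIndex r)
    c-charPoly-cycleG⊕cycleG κ r κ+r≡a+1 =
      trans (cong (coeffP A) degree∸κ) (coeffP-charPoly-cycleG⊕cycleG s d (topIndex r) a<top d<top)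
      where
      degree∸κ : degP A ∸ κ ≡ topIndex r
      degree∸κ = trans (cong (_∸ κ) (trans degP-charPoly-cycleG⊕cycleG (n≡topIndex+κ κ r κ+r≡a+1)))
                       (ℕ.m+n∸n≡m (topIndex r) κ)
      a<top : a < topIndex r
      a<top = s≤s (ℕ.≤-trans (ℕ.m≤m+n a e) (ℕ.m≤n+m (a ℕ.+ e) r))
      d<top : d < topIndex r
      d<top = s≤s (ℕ.≤-trans (ℕ.+-monoˡ-≤ e (s≤s (s≤s z≤n))) (ℕ.m≤n+m (a ℕ.+ e) r))

    coeffP-vietaLucas-a+d-top₀ : coeffP (v (a ℕ.+ d)) (topIndex 0) ≡ + 0
    coeffP-vietaLucas-a+d-top₀ =
      trans (cong (λ m → coeffP (v m) (topIndex 0)) (trans a+d≡ (cong suc (sym (ℕ.+-identityʳ (topIndex 0))))))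
            (coeffP-vietaLucas-odd (topIndex 0) 0)

    coeffP-vietaLucas-a+d-top₁ : coeffP (v (a ℕ.+ d)) (topIndex 1) ≡ + 1
    coeffP-vietaLucas-a+d-top₁ =
      trans (cong (λ m → coeffP (v m) (topIndex 1)) a+d≡) (coeffP-vietaLucas-leading (suc (a ℕ.+ e)))

    coeffP-vietaLucas-a+d-top₂₊ : ∀ r → coeffP (v (a ℕ.+ d)) (topIndex (suc (suc r))) ≡ + 0
    coeffP-vietaLucas-a+d-top₂₊ r = coeffP-vietaLucas-> (a ℕ.+ d) (topIndex (suc (suc r)))
      (subst (_< topIndex (suc (suc r))) (sym a+d≡) (s≤s (s≤s (s≤s (ℕ.m≤n+m (a ℕ.+ e) r)))))

    module _ (n≡2^[a+1][a+1]! : n ≡ 2 ^ suc a ℕ.* suc a !) where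

      private
        Γ : Graph (a ℕ.+ (a ℕ.+ d))
        Γ = cycleG a ⊕G cycleG (a ℕ.+ d)

        a+2∸1≡a+1 : a ℕ.+ 2 ∸ 1 ≡ suc a
        a+2∸1≡a+1 = cong (_∸ 1) (ℕ.+-comm a 2)

        topCoefficient-divisible : ∀ κ r → 1 ≤ κ → κ ℕ.+ r ≡ suc a →
                                   + (2 ^ suc a) ℤ.∣ coeffP (v n) (topIndex r)
        topCoefficient-divisible κ r 1≤κ κ+r≡a+1 =
          subst (λ m → + (2 ^ suc a) ℤ.∣ coeffP (v m) (topIndex r)) (sym n≡2^[a+1][a+1]!)
            (coeffP-vietaLucas-divisible a (topIndex r) κ 1≤κ (subst (κ ≤_) κ+r≡a+1 (ℕ.m≤m+n κ r))
              (trans (sym n≡2^[a+1][a+1]!) (n≡topIndex+κ κ r κ+r≡a+1)))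

        walks : ∀ k → + (2 ^ (a ℕ.+ 2 ∸ 2)) ∣ onesForm (powM (adjMatrix Γ) k)
        walks k = subst₂ (λ x y → + (2 ^ x) ∣ y) (sym (ℕ.m+n∸n≡m a 2)) (sym (onesForm-powM regular k)) (begin
          2 ^ a                                ∣⟨ ^-monoʳ-∣ 2 (ℕ.n≤1+n a) ⟩
          2 ^ suc a                            ∣⟨ m∣m*n (suc a !) ⟩
          2 ^ suc a ℕ.* suc a !                ≡⟨ trans (sym n≡2^[a+1][a+1]!) (ℕ.+-assoc a a d) ⟩
          a ℕ.+ (a ℕ.+ d)                      ∣⟨ m∣m*n (2 ^ k) ⟩
          (a ℕ.+ (a ℕ.+ d)) ℕ.* 2 ^ k          ∎)
          where
          open ℕ.∣-Reasoning
          regular : IsRowRegular 2 (adjMatrix Γ)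
          regular = rowSum-⊕G (cycleG a) (cycleG (a ℕ.+ d)) (cycleG-regular s) (cycleG-regular (s ℕ.+ d))

        coeffs-other : ∀ κ → 1 ≤ κ → κ ≤ a ℕ.+ 2 ∸ 1 → κ ≢ a → c_ κ A ≋ + 0 [mod 2 ^ (a ℕ.+ 2 ∸ κ) ]
        coeffs-other κ 1≤κ κ≤a+1 κ≢a with ℕ.m≤n⇒∃[o]m+o≡n (subst (κ ≤_) a+2∸1≡a+1 κ≤a+1)
        ... | r , κ+r≡a+1 = ∣⇒∣ᵤ (subst (+ (2 ^ (a ℕ.+ 2 ∸ κ)) ℤ.∣_) (sym c_κ-0≡)
                (ℤ.∣-trans (ℤ.∣ᵤ⇒∣ (^-monoʳ-∣ 2 a+2∸κ≤a+1)) (topCoefficient-divisible κ r 1≤κ κ+r≡a+1)))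
          where
          a+2∸κ≤a+1 : a ℕ.+ 2 ∸ κ ≤ suc a
          a+2∸κ≤a+1 = subst (a ℕ.+ 2 ∸ κ ≤_) a+2∸1≡a+1 (ℕ.∸-monoʳ-≤ (a ℕ.+ 2) 1≤κ)
          v[a+d]≡0 : ∀ r → κ ℕ.+ r ≡ suc a → coeffP (v (a ℕ.+ d)) (topIndex r) ≡ + 0
          v[a+d]≡0 zero _ = coeffP-vietaLucas-a+d-top₀
          v[a+d]≡0 (suc zero) κ+1≡a+1 = contradiction (ℕ.+-cancelʳ-≡ 1 κ a (trans κ+1≡a+1 (ℕ.+-comm 1 a))) κ≢a
          v[a+d]≡0 (suc (suc r)) _ = coeffP-vietaLucas-a+d-top₂₊ r
          c_κ-0≡ : c_ κ A ℤ.- + 0 ≡ coeffP (v n) (topIndex r)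
          c_κ-0≡ = begin
            c_ κ A ℤ.- + 0
              ≡⟨ ℤ.+-identityʳ (c_ κ A) ⟩
            c_ κ A
              ≡⟨ c-charPoly-cycleG⊕cycleG κ r κ+r≡a+1 ⟩
            coeffP (v n) (topIndex r) ℤ.- + 2 ℤ.* coeffP (v (a ℕ.+ d)) (topIndex r)
              ≡⟨ cong (λ y → coeffP (v n) (topIndex r) ℤ.- + 2 ℤ.* y) (v[a+d]≡0 r κ+r≡a+1) ⟩
            coeffP (v n) (topIndex r) ℤ.- + 0
              ≡⟨ ℤ.+-identityʳ (coeffP (v n) (topIndex r)) ⟩
            coeffP (v n) (topIndex r) ∎
            where open ≡.≡-Reasoning

        coeff-f : 1 ≤ a → a ≤ a ℕ.+ 2 ∸ 1 → c_ a A ≋ + (2 ^ (a ℕ.+ 2 ∸ a ∸ 1)) [mod 2 ^ (a ℕ.+ 2 ∸ a) ]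
        coeff-f _ _ = subst (λ t → + (2 ^ t) ∣ (c_ a A ℤ.- + (2 ^ (t ∸ 1)))) (sym (ℕ.m+n∸m≡n a 2))
          (∣⇒∣ᵤ (subst (+ 4 ℤ.∣_) (sym c_a-2≡)
            (ℤ.∣m∣n⇒∣m-n (ℤ.∣-trans (ℤ.∣ᵤ⇒∣ (^-monoʳ-∣ 2 {2} {suc a} (s≤s (s≤s z≤n))))
                                    (topCoefficient-divisible a 1 (s≤s z≤n) (ℕ.+-comm a 1)))
                         ℤ.∣-refl)))
          where
          c_a-2≡ : c_ a A ℤ.- + 2 ≡ coeffP (v n) (topIndex 1) ℤ.- + 4
          c_a-2≡ = begin
            c_ a A ℤ.- + 2
              ≡⟨ cong (ℤ._- + 2) (c-charPoly-cycleG⊕cycleG a 1 (ℕ.+-comm a 1)) ⟩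
            coeffP (v n) (topIndex 1) ℤ.- + 2 ℤ.* coeffP (v (a ℕ.+ d)) (topIndex 1) ℤ.- + 2
              ≡⟨ cong (λ y → coeffP (v n) (topIndex 1) ℤ.- + 2 ℤ.* y ℤ.- + 2) coeffP-vietaLucas-a+d-top₁ ⟩
            coeffP (v n) (topIndex 1) ℤ.- + 2 ℤ.* + 1 ℤ.- + 2
              ≡⟨ ℤ.+-assoc (coeffP (v n) (topIndex 1)) (ℤ.- + 2) (ℤ.- + 2) ⟩
            coeffP (v n) (topIndex 1) ℤ.- + 4 ∎
            where open ≡.≡-Reasoning

      liftTypeI-cycleG⊕cycleG : LiftTypeI (a ℕ.+ 2) a (cycleG a ⊕G cycleG (a ℕ.+ d))
      liftTypeI-cycleG⊕cycleG = record { walks = walks ; coeffs-other = coeffs-other ; coeff-f = coeff-f }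

  2*[1+m]≤2^[1+m]*[1+m]! : ∀ m → 2 ℕ.* suc m ≤ 2 ^ suc m ℕ.* suc m !
  2*[1+m]≤2^[1+m]*[1+m]! m = subst (_≤ 2 ^ suc m ℕ.* suc m !) (ones m)
    (ℕ.*-mono-≤ (ℕ.*-monoʳ-≤ 2 (ℕ.m^n>0 2 m)) (ℕ.*-monoʳ-≤ (suc m) (ℕ.1≤n! m)))
    where
    ones : ∀ m → 2 ℕ.* 1 ℕ.* (suc m ℕ.* 1) ≡ 2 ℕ.* suc m
    ones = ℕ-Solver.solve-∀

  ∃[e]2^[f+1][f+1]!≡f+f+2+e : ∀ f → Σ[ e ∈ ℕ ] 2 ^ (f ℕ.+ 1) ℕ.* (f ℕ.+ 1) ! ≡ f ℕ.+ f ℕ.+ suc (suc e)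
  ∃[e]2^[f+1][f+1]!≡f+f+2+e f = N ∸ (f ℕ.+ f ℕ.+ 2) , (begin
    N                                      ≡⟨ ℕ.m+[n∸m]≡n 2f+2≤N ⟨
    f ℕ.+ f ℕ.+ 2 ℕ.+ (N ∸ (f ℕ.+ f ℕ.+ 2)) ≡⟨ regroup f (N ∸ (f ℕ.+ f ℕ.+ 2)) ⟩
    f ℕ.+ f ℕ.+ suc (suc (N ∸ (f ℕ.+ f ℕ.+ 2))) ∎)
    where
    open ≡.≡-Reasoning
    N : ℕ
    N = 2 ^ (f ℕ.+ 1) ℕ.* (f ℕ.+ 1) !
    2f+2≤N : f ℕ.+ f ℕ.+ 2 ≤ N
    2f+2≤N = subst₂ _≤_ (double f) (cong (λ m → 2 ^ m ℕ.* m !) (ℕ.+-comm 1 f)) (2*[1+m]≤2^[1+m]*[1+m]! f)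
      where
      double : ∀ f → 2 ℕ.* suc f ≡ f ℕ.+ f ℕ.+ 2
      double = ℕ-Solver.solve-∀
    regroup : ∀ f e → f ℕ.+ f ℕ.+ 2 ℕ.+ e ≡ f ℕ.+ f ℕ.+ suc (suc e)
    regroup = ℕ-Solver.solve-∀

open CycleUnion

open import Data.Nat using (ℕ; zero; suc; s≤s; _+_; _*_; _^_; _∸_; _≤_; _!)
open import Data.Nat.Properties using (+-assoc; +-comm; m+n∸m≡n)
open import Data.Product using (proj₁; proj₂)
open import Relation.Binary.PropositionalEquality using (_≡_; sym; trans; cong; subst)

lemma4p3 : (f : ℕ) → 3 ≤ f →
    LiftTypeI (f + 2) f (cycleG f ⊕G cycleG (2 ^ (f + 1) * (f + 1) ! ∸ f))
lemma4p3 (suc zero) (s≤s ())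
lemma4p3 (suc (suc zero)) (s≤s (s≤s ()))
lemma4p3 f@(suc (suc (suc s))) _ =
  subst (λ m → LiftTypeI (f + 2) f (cycleG f ⊕G cycleG m)) (sym N∸f≡f+d)
        (liftTypeI-cycleG⊕cycleG s e f+f+d≡N)
  where
  N e : ℕ
  N = 2 ^ (f + 1) * (f + 1) !
  e = proj₁ (∃[e]2^[f+1][f+1]!≡f+f+2+e f)
  N≡f+f+d : N ≡ f + f + suc (suc e)
  N≡f+f+d = proj₂ (∃[e]2^[f+1][f+1]!≡f+f+2+e f)
  N∸f≡f+d : N ∸ f ≡ f + suc (suc e)
  N∸f≡f+d = trans (cong (_∸ f) (trans N≡f+f+d (+-assoc f f (suc (suc e))))) (m+n∸m≡n f (f + suc (suc e)))
  f+f+d≡N : f + f + suc (suc e) ≡ 2 ^ suc f * suc f !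
  f+f+d≡N = trans (sym N≡f+f+d) (cong (λ m → 2 ^ m * m !) (+-comm f 1))
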